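{- For every hypergraph $G$ there exists a polynomial $P_{\subset,\cap}(G)\in\mathbb{K}[X]$ such that for every integer $N\geq1$, $P_{\subset,\cap}(G)(N)$ is the number of maps $f:V(G)\to\{1,\dots,N\}$ such that for every $e\in E^+(G)$, $\max\{f(x)\mid x\in e\}$ is attained at exactly one element of $e$. Moreover, the linear map $P_{\subset,\cap}:(\mathcal{F}[\mathbf{H}],m,\Delta^{(\subset,\cap)})\to(\mathbb{K}[X],m,\Delta)$ is a Hopf algebra morphism.
   Context: $\mathbb{K}$ is a field of characteristic zero. A hypergraph is a pair $G=(V(G),E(G))$ with $V(G)$ finite and $E(G)\subseteq\mathcal{P}(V(G))$ containing $\emptyset$ and all singletons; $E^+(G)=\{e\in E(G)\mid|e|\geq2\}$. For $I\subseteq V(G)$: $G_{\mid_\subset I}$ has vertex set $I$ and edges $\{e\in E(G)\mid e\subseteq I\}$; $G_{\mid_\cap I}$ has vertex set $I$ and edges $\{e\cap I\mid e\in E(G)\}$. $\mathcal{F}[\mathbf{H}]$ is the $\mathbb{K}$-vector space with basis the isomorphism classes of hypergraphs, with product $m$ given by disjoint union ($GG'$: vertex set $V(G)\sqcup V(G')$, edges $E(G)\cup E(G')$) and coproduct $\Delta^{(\subset,\cap)}(G)=\sum_{I\subseteq V(G)}G_{\mid_\subset I}\otimes G_{\mid_\cap V(G)\setminus I}$. $\mathbb{K}[X]$ carries the multiplicative coproduct $\Delta$ with $\Delta(X)=X\otimes1+1\otimes X$. -}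

module Defs where

open import Level using (Level; _⊔_) renaming (suc to lsuc)
open import Data.Bool using (Bool; true; false; _∧_; _∨_; not; if_then_else_)
open import Data.Nat using (ℕ; zero; suc; _≡ᵇ_; _≤ᵇ_) renaming (_⊔_ to _⊔ℕ_; _+_ to _+ℕ_)
open import Data.Fin using (Fin; toℕ)
open import Data.Fin.Subset using (Subset; ⁅_⁆) renaming (⊥ to ∅ˢ)
open import Data.Fin.Permutation using (Permutation; _⟨$⟩ˡ_)
open import Data.Vec using (Vec; []; _∷_; lookup; tabulate)
open import Data.List using (List; []; _∷_; [_]; map; _++_; concatMap; allFin; filter; length; foldr)
open import Data.Bool.ListAction using (all; any)
open import Data.Product using (Σ; Σ-syntax; _×_; ∃)
open import Data.Unit.Polymorphic using (⊤)
open import Relation.Nullary using (¬_)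
open import Relation.Binary.PropositionalEquality using (_≡_)
open import Algebra.Bundles using (CommutativeRing)

record Field (c ℓ : Level) : Set (lsuc (c ⊔ ℓ)) where
  field
    commutativeRing : CommutativeRing c ℓ
  open CommutativeRing commutativeRing public
  field
    1≉0     : ¬ (1# ≈ 0#)
    inverse : ∀ x → ¬ (x ≈ 0#) → ∃ λ y → (x * y) ≈ 1#

module _ {c ℓ : Level} (K : Field c ℓ) where
  open Field K

  ι : ℕ → Carrier
  ι zero    = 0#
  ι (suc n) = 1# + ι n

  CharZero : Set ℓ
  CharZero = ∀ n → ¬ (ι (suc n) ≈ 0#)

  -- K[X]: coefficient lists, lowest degree first; equality up to
  -- trailing zeros.

  Poly : Set c
  Poly = List Carrier

  _≈P_ : Poly → Poly → Set ℓ
  []      ≈P []      = ⊤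
  []      ≈P (b ∷ q) = (b ≈ 0#) × ([] ≈P q)
  (a ∷ p) ≈P []      = (a ≈ 0#) × (p ≈P [])
  (a ∷ p) ≈P (b ∷ q) = (a ≈ b) × (p ≈P q)

  _+P_ : Poly → Poly → Poly
  []      +P q       = q
  (a ∷ p) +P []      = a ∷ p
  (a ∷ p) +P (b ∷ q) = (a + b) ∷ (p +P q)

  _·P_ : Carrier → Poly → Poly
  a ·P q = map (a *_) q

  _*P_ : Poly → Poly → Poly
  []      *P q = []
  (a ∷ p) *P q = (a ·P q) +P (0# ∷ (p *P q))

  1P : Poly
  1P = [ 1# ]

  eval : Poly → Carrier → Carrier
  eval []      x = 0#
  eval (a ∷ p) x = a + x * eval p x

  -- K[X] ⊗ K[X] ≅ K[X,Y]: an element is a list (indexed by the power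
  -- of X) of polynomials in Y; equality up to trailing zeros.

  Tensor : Set c
  Tensor = List Poly

  _≈T_ : Tensor → Tensor → Set ℓ
  []      ≈T []      = ⊤
  []      ≈T (q ∷ t) = (q ≈P []) × ([] ≈T t)
  (p ∷ s) ≈T []      = (p ≈P []) × (s ≈T [])
  (p ∷ s) ≈T (q ∷ t) = (p ≈P q) × (s ≈T t)

  _+T_ : Tensor → Tensor → Tensor
  []      +T t       = t
  (p ∷ s) +T []      = p ∷ s
  (p ∷ s) +T (q ∷ t) = (p +P q) ∷ (s +T t)

  sumT : List Tensor → Tensor
  sumT = foldr _+T_ []

  _⊗_ : Poly → Poly → Tensor
  p ⊗ q = map (_·P q) p

  -- the coproduct of K[X]: the algebra morphism with
  -- Δ X = X ⊗ 1 + 1 ⊗ X, computed by Horner: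
  -- Δ (a + X p) = a (1 ⊗ 1) + (X ⊗ 1 + 1 ⊗ X) Δ p
  ΔP : Poly → Tensor
  ΔP []      = []
  ΔP (a ∷ p) = ([ [ a ] ] +T ([] ∷ ΔP p)) +T map (0# ∷_) (ΔP p)

  εP : Poly → Carrier
  εP p = eval p 0#

-- Hypergraphs: vertex set Fin n, edge set a finite set of subsets
-- (given by its indicator function on Subset n).

record HG : Set where
  constructor hg
  field
    n : ℕ
    E : Subset n → Bool
open HG public

IsHypergraph : HG → Set
IsHypergraph G = (E G ∅ˢ ≡ true) × (∀ i → E G ⁅ i ⁆ ≡ true)

allSubsets : ∀ n → List (Subset n)
allSubsets zero    = [ [] ]
allSubsets (suc n) = map (true ∷_) (allSubsets n) ++ map (false ∷_) (allSubsets n)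

size : ∀ {n} → Subset n → ℕ
size []          = 0
size (true ∷ s)  = suc (size s)
size (false ∷ s) = size s

isEmpty : ∀ {n} → Subset n → Bool
isEmpty []          = true
isEmpty (true ∷ s)  = false
isEmpty (false ∷ s) = isEmpty s

eqB : Bool → Bool → Bool
eqB true  b = b
eqB false b = not b

eqSub : ∀ {n} → Subset n → Subset n → Bool
eqSub []      []      = true
eqSub (a ∷ s) (b ∷ t) = eqB a b ∧ eqSub s t

-- e ↦ e ∩ I, viewed as a subset of I ≅ Fin (size I)
compress : ∀ {n} (I : Subset n) → Subset n → Subset (size I)
compress []          []      = []
compress (true ∷ I)  (b ∷ e) = b ∷ compress I e
compress (false ∷ I) (b ∷ e) = compress I e

-- a subset of I ≅ Fin (size I), viewed as a subset of Fin n
expand : ∀ {n} (I : Subset n) → Subset (size I) → Subset n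
expand []          e       = []
expand (true ∷ I)  (b ∷ e) = b ∷ expand I e
expand (false ∷ I) e       = false ∷ expand I e

complement : ∀ {n} → Subset n → Subset n
complement []      = []
complement (b ∷ s) = not b ∷ complement s

-- G|⊂I : edges e ∈ E(G) with e ⊆ I
restrictSub : (G : HG) → Subset (n G) → HG
restrictSub G I = hg (size I) (λ e′ → E G (expand I e′))

-- G|∩I : edges e ∩ I for e ∈ E(G)
restrictCap : (G : HG) → Subset (n G) → HG
restrictCap G I =
  hg (size I) (λ e′ → any (λ e → E G e ∧ eqSub (compress I e) e′) (allSubsets (n G)))

left : ∀ {A : Set} n {m} → Vec A (n +ℕ m) → Vec A n
left zero    v       = []
left (suc n) (x ∷ v) = x ∷ left n v

right : ∀ {A : Set} n {m} → Vec A (n +ℕ m) → Vec A m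
right zero    v       = v
right (suc n) (x ∷ v) = right n v

-- disjoint union GG′ : vertices Fin (n + n′), edges E(G) ∪ E(G′)
_⊎H_ : HG → HG → HG
hg n₁ E₁ ⊎H hg n₂ E₂ = hg (n₁ +ℕ n₂) (λ v →
  (E₁ (left n₁ v) ∧ isEmpty (right n₁ v)) ∨ (isEmpty (left n₁ v) ∧ E₂ (right n₁ v)))

emptyHG : HG
emptyHG = hg 0 (λ _ → true)

image : ∀ {n m} → Permutation n m → Subset n → Subset m
image σ e = tabulate (λ j → lookup e (σ ⟨$⟩ˡ j))

Iso : HG → HG → Set
Iso G G′ = Σ[ σ ∈ Permutation (n G) (n G′) ] (∀ e → E G e ≡ E G′ (image σ e))

-- Counting maps f : V(G) → {1..N} (encoded as Fin N, order preserved)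
-- such that on each edge e with |e| ≥ 2 the maximum of f is attained
-- at exactly one vertex.

allMaps : ∀ n N → List (Vec (Fin N) n)
allMaps zero    N = [ [] ]
allMaps (suc n) N = concatMap (λ x → map (x ∷_) (allMaps n N)) (allFin N)

members : ∀ {n} → Subset n → List (Fin n)
members {n} e = filter (λ i → lookup e i Data.Bool.≟ true) (allFin n)
  where import Data.Bool

uniqueMax : ∀ {n N} → Vec (Fin N) n → Subset n → Bool
uniqueMax f e =
  length (filter (λ i → toℕ (lookup f i) Data.Nat.≟ mx) (members e)) ≡ᵇ 1
  where
    import Data.Nat
    mx : ℕ
    mx = foldr (λ i r → toℕ (lookup f i) ⊔ℕ r) 0 (members e)

goodMap : ∀ {N} (G : HG) → Vec (Fin N) (n G) → Bool
goodMap G f =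
  all (λ e → not (E G e ∧ (2 ≤ᵇ size e)) ∨ uniqueMax f e) (allSubsets (n G))

countGood : HG → ℕ → ℕ
countGood G N = length (filter (λ f → goodMap G f Data.Bool.≟ true) (allMaps (n G) N))
  where import Data.Bool

module Submission where

open import Defs
open import Level using (Level)
open import Data.Nat using (ℕ; _≤_; _≡ᵇ_)
open import Data.Bool using (if_then_else_)
open import Data.List using (map)
open import Data.Product using (Σ; _×_)
open import Relation.Binary.PropositionalEquality using (_≡_)
open import Algebra.Bundles using (CommutativeRing)
open import Data.Product using (_,_)

-- Write c_G(N) = countGood G N and split the colours 1, …, N + M into N low and M high
-- ones. A colouring is then the same as a set I of vertices receiving low colours, a low
-- colouring a of I and a high colouring b of V ∖ I; it is good for G iff a is good for G|⊂I
-- and b is good for G|∩(V ∖ I), because an edge inside I sees only a, while on an edge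
-- meeting V ∖ I the maximum is high, so only the trace of the edge on V ∖ I matters. Hence
--   c_G(N + M) = Σ_I c_{G|⊂I}(N) · c_{G|∩(V∖I)}(M).
-- For M = 1 this expresses c_G(N + 1) − c_G(N) through hypergraphs with fewer vertices, so by
-- induction c_G is a ℕ-combination of the binomial coefficients (N choose k), and P(G) is the
-- same combination of the polynomials X (X − 1) ⋯ (X − k + 1) / k!. In characteristic zero a
-- polynomial in one or two variables is determined by its values at the points ι N, so the
-- Hopf-morphism identities follow from the counting identity above, from c_{GG′} = c_G c_{G′}
-- and from the invariance of c_G under isomorphism.

module Sums where
  open import Data.Bool using (Bool; true; false)
  import Data.Bool as Bool
  open import Data.Nat
  open import Data.Nat.Properties
  open import Data.Fin using (Fin; zero; suc; _↑ˡ_; _↑ʳ_)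
  open import Data.List using (List; []; _∷_; _++_; map; concatMap; allFin; filter; length; tabulate)
  open import Data.List.Properties using (map-tabulate)
  open import Data.List.Membership.Propositional using (_∈_; _∉_)
  open import Data.List.Membership.Propositional.Properties using (∈-∃++; ∈-++⁺ʳ)
  open import Data.List.Relation.Unary.Any using (here; there)
  import Data.List.Relation.Unary.All as All
  open import Data.List.Relation.Unary.AllPairs using (_∷_)
  open import Data.List.Relation.Unary.Unique.Propositional using (Unique)
  open import Data.List.Relation.Unary.Unique.Propositional.Properties using (Unique[x∷xs]⇒x∉xs)
  open import Data.Product using (_×_; _,_; proj₁; proj₂)
  open import Data.Empty using (⊥-elim)
  open import Function using (_∘_)
  open import Relation.Binary.PropositionalEquality
  open ≡-Reasoning
  open import Algebra.Properties.CommutativeSemigroup +-commutativeSemigroup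
    using () renaming (interchange to +-interchange)

  indicator : Bool → ℕ
  indicator true  = 1
  indicator false = 0

  sumOver : ∀ {A : Set} → (A → ℕ) → List A → ℕ
  sumOver f []       = 0
  sumOver f (x ∷ xs) = f x + sumOver f xs

  private variable A B : Set

  length-filter : ∀ (p : A → Bool) xs →
    length (filter (λ x → p x Bool.≟ true) xs) ≡ sumOver (indicator ∘ p) xs
  length-filter p [] = refl
  length-filter p (x ∷ xs) with p x
  ... | true  = cong suc (length-filter p xs)
  ... | false = length-filter p xs

  sumOver-cong-∈ : ∀ {f g : A → ℕ} xs → (∀ {x} → x ∈ xs → f x ≡ g x) → sumOver f xs ≡ sumOver g xs
  sumOver-cong-∈ []       eq = refl
  sumOver-cong-∈ (x ∷ xs) eq = cong₂ _+_ (eq (here refl)) (sumOver-cong-∈ xs (eq ∘ there))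

  sumOver-cong : ∀ {f g : A → ℕ} → (∀ x → f x ≡ g x) → ∀ xs → sumOver f xs ≡ sumOver g xs
  sumOver-cong eq xs = sumOver-cong-∈ xs (λ {x} _ → eq x)

  sumOver-++ : ∀ (f : A → ℕ) xs ys → sumOver f (xs ++ ys) ≡ sumOver f xs + sumOver f ys
  sumOver-++ f []       ys = refl
  sumOver-++ f (x ∷ xs) ys = trans (cong (f x +_) (sumOver-++ f xs ys)) (sym (+-assoc (f x) _ _))

  sumOver-map : ∀ (f : B → ℕ) (g : A → B) xs → sumOver f (map g xs) ≡ sumOver (f ∘ g) xs
  sumOver-map f g []       = refl
  sumOver-map f g (x ∷ xs) = cong (f (g x) +_) (sumOver-map f g xs)

  sumOver-concatMap : ∀ (f : B → ℕ) (g : A → List B) xs →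
    sumOver f (concatMap g xs) ≡ sumOver (sumOver f ∘ g) xs
  sumOver-concatMap f g []       = refl
  sumOver-concatMap f g (x ∷ xs) =
    trans (sumOver-++ f (g x) _) (cong (sumOver f (g x) +_) (sumOver-concatMap f g xs))

  sumOver-zero : ∀ xs → sumOver (λ (_ : A) → 0) xs ≡ 0
  sumOver-zero []       = refl
  sumOver-zero (x ∷ xs) = sumOver-zero xs

  sumOver-distrib-+ : ∀ (f g : A → ℕ) xs → sumOver (λ x → f x + g x) xs ≡ sumOver f xs + sumOver g xs
  sumOver-distrib-+ f g []       = refl
  sumOver-distrib-+ f g (x ∷ xs) =
    trans (cong (f x + g x +_) (sumOver-distrib-+ f g xs)) (+-interchange (f x) (g x) _ _)

  *-distribˡ-sumOver : ∀ c (f : A → ℕ) xs → sumOver (λ x → c * f x) xs ≡ c * sumOver f xs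
  *-distribˡ-sumOver c f []       = sym (*-zeroʳ c)
  *-distribˡ-sumOver c f (x ∷ xs) =
    trans (cong (c * f x +_) (*-distribˡ-sumOver c f xs)) (sym (*-distribˡ-+ c (f x) _))

  *-distribʳ-sumOver : ∀ c (f : A → ℕ) xs → sumOver (λ x → f x * c) xs ≡ sumOver f xs * c
  *-distribʳ-sumOver c f xs =
    trans (sumOver-cong (λ x → *-comm (f x) c) xs) (trans (*-distribˡ-sumOver c f xs) (*-comm c _))

  sumOver-comm : ∀ (F : A → B → ℕ) xs ys →
    sumOver (λ x → sumOver (F x) ys) xs ≡ sumOver (λ y → sumOver (λ x → F x y) xs) ys
  sumOver-comm F []       ys = sym (sumOver-zero ys)
  sumOver-comm F (x ∷ xs) ys =
    trans (cong (sumOver (F x) ys +_) (sumOver-comm F xs ys)) (sym (sumOver-distrib-+ (F x) _ ys))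

  sumOver-product : ∀ (f : A → ℕ) (g : B → ℕ) xs ys →
    sumOver (λ x → sumOver (λ y → f x * g y) ys) xs ≡ sumOver f xs * sumOver g ys
  sumOver-product f g xs ys = begin
    sumOver (λ x → sumOver (λ y → f x * g y) ys) xs ≡⟨ sumOver-cong (λ x → *-distribˡ-sumOver (f x) g ys) xs ⟩
    sumOver (λ x → f x * sumOver g ys) xs          ≡⟨ *-distribʳ-sumOver (sumOver g ys) f xs ⟩
    sumOver f xs * sumOver g ys                    ∎

  sumOver-tabulate : ∀ {n} (f : A → ℕ) (g : Fin n → A) →
    sumOver f (tabulate g) ≡ sumOver (f ∘ g) (allFin n)
  sumOver-tabulate f g = trans (cong (sumOver f) (sym (map-tabulate (λ i → i) g))) (sumOver-map f g (allFin _))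

  sumOver-allFin-+ : ∀ N {M} (h : Fin (N + M) → ℕ) →
    sumOver h (allFin (N + M)) ≡ sumOver (h ∘ (_↑ˡ M)) (allFin N) + sumOver (h ∘ (N ↑ʳ_)) (allFin M)
  sumOver-allFin-+ zero    h = refl
  sumOver-allFin-+ (suc N) {M} h = begin
    h zero + sumOver h (tabulate suc)                          ≡⟨ cong (h zero +_) (sumOver-tabulate h suc) ⟩
    h zero + sumOver (h ∘ suc) (allFin (N + _))                ≡⟨ cong (h zero +_) (sumOver-allFin-+ N (h ∘ suc)) ⟩
    h zero + (sumOver (h ∘ suc ∘ (_↑ˡ M)) (allFin N) + R)      ≡⟨ +-assoc (h zero) _ R ⟨
    h zero + sumOver (h ∘ suc ∘ (_↑ˡ M)) (allFin N) + R
      ≡⟨ cong (λ s → h zero + s + R) (sumOver-tabulate (h ∘ (_↑ˡ M)) suc) ⟨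
    h zero + sumOver (h ∘ (_↑ˡ M)) (tabulate suc) + R          ∎
    where R = sumOver (h ∘ (suc N ↑ʳ_)) (allFin M)

  private
    ∈-dropMiddle : ∀ (ys₁ : List A) {x ys₂ z} → z ∈ ys₁ ++ (x ∷ ys₂) → z ≢ x → z ∈ ys₁ ++ ys₂
    ∈-dropMiddle []        (here refl) z≢x = ⊥-elim (z≢x refl)
    ∈-dropMiddle []        (there z∈)  z≢x = z∈
    ∈-dropMiddle (y ∷ ys₁) (here refl) z≢x = here refl
    ∈-dropMiddle (y ∷ ys₁) (there z∈)  z≢x = there (∈-dropMiddle ys₁ z∈ z≢x)

    ∈-addMiddle : ∀ (ys₁ : List A) {x ys₂ z} → z ∈ ys₁ ++ ys₂ → z ∈ ys₁ ++ (x ∷ ys₂)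
    ∈-addMiddle []        z∈          = there z∈
    ∈-addMiddle (y ∷ ys₁) (here refl) = here refl
    ∈-addMiddle (y ∷ ys₁) (there z∈)  = there (∈-addMiddle ys₁ z∈)

    unique-dropMiddle : ∀ (ys₁ : List A) {x ys₂} → Unique (ys₁ ++ (x ∷ ys₂)) →
      Unique (ys₁ ++ ys₂) × x ∉ ys₁ ++ ys₂
    unique-dropMiddle []        u@(_ ∷ u′) = u′ , Unique[x∷xs]⇒x∉xs u
    unique-dropMiddle (y ∷ ys₁) (y∉ ∷ u)   =
      let u′ , x∉ = unique-dropMiddle ys₁ u in
      All.tabulate (All.lookup y∉ ∘ ∈-addMiddle ys₁) ∷ u′ ,
      λ { (here refl) → All.lookup y∉ (∈-++⁺ʳ ys₁ (here refl)) refl ; (there x∈) → x∉ x∈ }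

  sumOver-sameElements : ∀ (f : A → ℕ) xs ys → Unique xs → Unique ys →
    (∀ {z} → z ∈ xs → z ∈ ys) → (∀ {z} → z ∈ ys → z ∈ xs) → sumOver f xs ≡ sumOver f ys
  sumOver-sameElements f [] [] _ _ _ _ = refl
  sumOver-sameElements f [] (y ∷ ys) _ _ _ ys⊆ with ys⊆ (here refl)
  ... | ()
  sumOver-sameElements f (x ∷ xs) ys (x∉ ∷ uxs) uys xs⊆ ys⊆ with ∈-∃++ (xs⊆ (here refl))
  ... | ys₁ , ys₂ , refl = begin
    f x + sumOver f xs                ≡⟨ cong (f x +_) (sumOver-sameElements f xs _ uxs u′ xs⊆′ ys⊆′) ⟩
    f x + sumOver f (ys₁ ++ ys₂)      ≡⟨ cong (f x +_) (sumOver-++ f ys₁ ys₂) ⟩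
    f x + (sumOver f ys₁ + sumOver f ys₂) ≡⟨ +-assoc (f x) _ _ ⟨
    f x + sumOver f ys₁ + sumOver f ys₂   ≡⟨ cong (_+ sumOver f ys₂) (+-comm (f x) _) ⟩
    sumOver f ys₁ + f x + sumOver f ys₂   ≡⟨ +-assoc (sumOver f ys₁) _ _ ⟩
    sumOver f ys₁ + (f x + sumOver f ys₂) ≡⟨ sumOver-++ f ys₁ (x ∷ ys₂) ⟨
    sumOver f (ys₁ ++ (x ∷ ys₂))      ∎
    where
    u′ = proj₁ (unique-dropMiddle ys₁ uys)
    xs⊆′ : ∀ {z} → z ∈ xs → z ∈ ys₁ ++ ys₂
    xs⊆′ z∈ = ∈-dropMiddle ys₁ (xs⊆ (there z∈)) λ { refl → All.lookup x∉ z∈ refl }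
    ys⊆′ : ∀ {z} → z ∈ ys₁ ++ ys₂ → z ∈ xs
    ys⊆′ z∈ with ys⊆ (∈-addMiddle ys₁ z∈)
    ... | here refl = ⊥-elim (proj₂ (unique-dropMiddle ys₁ uys) z∈)
    ... | there z∈xs = z∈xs

module Colourings where
  open Sums
  open import Data.Bool using (true; false)
  open import Data.Nat
  open import Data.Nat.Properties
  open import Data.Fin using (Fin; _↑ˡ_; _↑ʳ_)
  open import Data.Fin.Subset using (Subset)
  open import Data.Vec using (Vec; []; _∷_; _++_; head)
  import Data.Vec.Properties as Vec
  open import Data.List using ([]; _∷_; map; concatMap; allFin)
  open import Data.List.Membership.Propositional using (_∈_)
  open import Data.List.Membership.Propositional.Properties
  open import Data.List.Relation.Unary.Any using (here; there)
  import Data.List.Relation.Unary.Any as Any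
  import Data.List.Relation.Unary.All as All
  open import Data.List.Relation.Unary.AllPairs using ([]; _∷_)
  open import Data.List.Relation.Unary.Unique.Propositional using (Unique)
  open import Data.List.Relation.Unary.Unique.Propositional.Properties
  open import Data.Product using (_,_)
  open import Data.Sum using (inj₁; inj₂)
  open import Function using (_∘_)
  open import Relation.Binary.PropositionalEquality
  open ≡-Reasoning

  ∈-allMaps : ∀ {n N} (f : Vec (Fin N) n) → f ∈ allMaps n N
  ∈-allMaps []               = here refl
  ∈-allMaps {suc n} {N} (x ∷ f) =
    ∈-concatMap⁺ (λ y → map (y ∷_) (allMaps n N)) (Any.map (λ { refl → ∈-map⁺ (x ∷_) (∈-allMaps f) }) (∈-allFin x))

  allMaps-unique : ∀ n N → Unique (allMaps n N)
  allMaps-unique zero    N = All.[] ∷ []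
  allMaps-unique (suc n) N = columns (allFin N) (allFin⁺ N)
    where
    heads : ∀ xs {v} → v ∈ concatMap (λ x → map (x ∷_) (allMaps n N)) xs → head v ∈ xs
    heads (x ∷ xs) v∈ with ∈-++⁻ (map (x ∷_) (allMaps n N)) v∈
    ... | inj₁ v∈′ = let _ , _ , v≡ = ∈-map⁻ (x ∷_) v∈′ in here (cong head v≡)
    ... | inj₂ v∈′ = there (heads xs v∈′)
    columns : ∀ xs → Unique xs → Unique (concatMap (λ x → map (x ∷_) (allMaps n N)) xs)
    columns []       _          = []
    columns (x ∷ xs) (x∉ ∷ uxs) =
      ++⁺ (map⁺ Vec.∷-injectiveʳ (allMaps-unique n N)) (columns xs uxs)
        λ { (v∈ , v∈′) → let _ , _ , v≡ = ∈-map⁻ (x ∷_) v∈ in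
              All.lookup x∉ (subst (_∈ xs) (cong head v≡) (heads xs v∈′)) refl }

  sumColourings : ∀ n N → (Vec (Fin N) n → ℕ) → ℕ
  sumColourings n N F = sumOver F (allMaps n N)

  sumColourings-cong : ∀ n N {F G : Vec (Fin N) n → ℕ} → (∀ f → F f ≡ G f) →
    sumColourings n N F ≡ sumColourings n N G
  sumColourings-cong n N eq = sumOver-cong eq (allMaps n N)

  sumColourings-[] : ∀ N F → sumColourings 0 N F ≡ F []
  sumColourings-[] N F = +-identityʳ (F [])

  sumColourings-∷ : ∀ n N F →
    sumColourings (suc n) N F ≡ sumOver (λ x → sumColourings n N (F ∘ (x ∷_))) (allFin N)
  sumColourings-∷ n N F = trans (sumOver-concatMap F _ (allFin N))
    (sumOver-cong (λ x → sumOver-map F (x ∷_) (allMaps n N)) (allFin N))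

  sumColourings-++ : ∀ n m N F →
    sumColourings (n + m) N F ≡ sumColourings n N (λ a → sumColourings m N (λ b → F (a ++ b)))
  sumColourings-++ zero    m N F = sym (sumColourings-[] N (λ a → sumColourings m N (λ b → F (a ++ b))))
  sumColourings-++ (suc n) m N F = begin
    sumColourings (suc n + m) N F
      ≡⟨ sumColourings-∷ (n + m) N F ⟩
    sumOver (λ x → sumColourings (n + m) N (F ∘ (x ∷_))) (allFin N)
      ≡⟨ sumOver-cong (λ x → sumColourings-++ n m N (F ∘ (x ∷_))) (allFin N) ⟩
    sumOver (λ x → sumColourings n N (λ a → sumColourings m N (λ b → F (x ∷ a ++ b)))) (allFin N)
      ≡⟨ sumColourings-∷ n N _ ⟨
    sumColourings (suc n) N (λ a → sumColourings m N (λ b → F (a ++ b))) ∎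

  sumColourings-reindex : ∀ {n n′ N} (φ : Vec (Fin N) n → Vec (Fin N) n′) (ψ : Vec (Fin N) n′ → Vec (Fin N) n) →
    (∀ f → ψ (φ f) ≡ f) → (∀ g → φ (ψ g) ≡ g) → ∀ F → sumColourings n′ N F ≡ sumColourings n N (F ∘ φ)
  sumColourings-reindex {n} {n′} {N} φ ψ ψφ φψ F = begin
    sumOver F (allMaps n′ N)
      ≡⟨ sumOver-sameElements F _ _ (map⁺ φ-injective (allMaps-unique n N)) (allMaps-unique n′ N)
           (λ {g} _ → ∈-allMaps g) (λ {g} _ → subst (_∈ _) (φψ g) (∈-map⁺ φ (∈-allMaps (ψ g)))) ⟨
    sumOver F (map φ (allMaps n N)) ≡⟨ sumOver-map F φ (allMaps n N) ⟩
    sumOver (F ∘ φ) (allMaps n N)   ∎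
    where
    φ-injective : ∀ {f f′} → φ f ≡ φ f′ → f ≡ f′
    φ-injective {f} {f′} eq = trans (sym (ψφ f)) (trans (cong ψ eq) (ψφ f′))

  merge : ∀ {n N M} (I : Subset n) → Vec (Fin N) (size I) → Vec (Fin M) (size (complement I)) →
    Vec (Fin (N + M)) n
  merge []               a       b       = []
  merge {M = M} (true ∷ I)  (x ∷ a) b       = (x ↑ˡ M) ∷ merge I a b
  merge {N = N} (false ∷ I) a       (y ∷ b) = (N ↑ʳ y) ∷ merge I a b

  sumMerges : ∀ {n} N M → (Vec (Fin (N + M)) n → ℕ) → Subset n → ℕ
  sumMerges N M F I =
    sumColourings (size I) N λ a → sumColourings (size (complement I)) M λ b → F (merge I a b)

  sumColourings-merge : ∀ n N M F → sumColourings n (N + M) F ≡ sumOver (sumMerges N M F) (allSubsets n)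
  sumColourings-merge zero    N M F =
    trans (sumColourings-[] (N + M) F) (sym (trans (+-identityʳ _)
      (trans (sumColourings-[] N (λ a → sumColourings 0 M (F ∘ merge [] a))) (sumColourings-[] M (F ∘ merge [] [])))))
  sumColourings-merge (suc n) N M F = begin
    sumColourings (suc n) (N + M) F
      ≡⟨ sumColourings-∷ n (N + M) F ⟩
    sumOver (λ z → sumColourings n (N + M) (F ∘ (z ∷_))) (allFin (N + M))
      ≡⟨ sumOver-allFin-+ N _ ⟩
    sumOver (λ x → sumColourings n (N + M) (F ∘ ((x ↑ˡ M) ∷_))) (allFin N) +
    sumOver (λ y → sumColourings n (N + M) (F ∘ ((N ↑ʳ y) ∷_))) (allFin M)
      ≡⟨ cong₂ _+_ (sumOver-cong (λ x → sumColourings-merge n N M _) (allFin N))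
                   (sumOver-cong (λ y → sumColourings-merge n N M _) (allFin M)) ⟩
    sumOver (λ x → sumOver (sumMerges N M (F ∘ ((x ↑ˡ M) ∷_))) Iₙ) (allFin N) +
    sumOver (λ y → sumOver (sumMerges N M (F ∘ ((N ↑ʳ y) ∷_))) Iₙ) (allFin M)
      ≡⟨ cong₂ _+_ (sumOver-comm _ (allFin N) Iₙ) (sumOver-comm _ (allFin M) Iₙ) ⟩
    sumOver (λ I → sumOver (λ x → sumMerges N M (F ∘ ((x ↑ˡ M) ∷_)) I) (allFin N)) Iₙ +
    sumOver (λ I → sumOver (λ y → sumMerges N M (F ∘ ((N ↑ʳ y) ∷_)) I) (allFin M)) Iₙ
      ≡⟨ cong₂ _+_ (sumOver-cong (λ I → sym (sumColourings-∷ (size I) N _)) Iₙ)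
                   (sumOver-cong highFirst Iₙ) ⟩
    sumOver (sumMerges N M F ∘ (true ∷_)) Iₙ + sumOver (sumMerges N M F ∘ (false ∷_)) Iₙ
      ≡⟨ cong₂ _+_ (sumOver-map _ (true ∷_) Iₙ) (sumOver-map _ (false ∷_) Iₙ) ⟨
    sumOver (sumMerges N M F) (map (true ∷_) Iₙ) + sumOver (sumMerges N M F) (map (false ∷_) Iₙ)
      ≡⟨ sumOver-++ (sumMerges N M F) (map (true ∷_) Iₙ) _ ⟨
    sumOver (sumMerges N M F) (allSubsets (suc n)) ∎
    where
    Iₙ = allSubsets n
    highFirst : ∀ I → sumOver (λ y → sumMerges N M (F ∘ ((N ↑ʳ y) ∷_)) I) (allFin M) ≡ sumMerges N M F (false ∷ I)
    highFirst I = trans (sym (sumOver-comm _ (allMaps (size I) N) (allFin M)))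
      (sumColourings-cong (size I) N (λ a → sym (sumColourings-∷ (size (complement I)) M _)))

module UniqueMaxima where
  open import Data.Bool using (Bool; true; false; T; not; _∧_; _∨_)
  import Data.Bool as Bool
  open import Data.Bool.Properties using (T-∧)
  open import Data.Nat
  open import Data.Nat.Properties
  open import Data.Fin using (Fin; zero; suc; toℕ)
  import Data.Fin as Fin
  import Data.Fin.Properties as Fin
  open import Data.Fin.Subset using (Subset)
  open import Data.Vec using (Vec; []; _∷_; lookup)
  open import Data.List using (List; []; _∷_; map; allFin; filter; length; foldr)
  open import Data.List.Membership.Propositional using (_∈_; find; lose)
  open import Data.List.Membership.Propositional.Properties
  open import Data.List.Relation.Unary.Any using (here; there)
  import Data.List.Relation.Unary.All as All
  open import Data.List.Relation.Unary.All.Properties using (all⁺; all⁻)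
  open import Data.List.Relation.Unary.Any.Properties using (any⁺; any⁻)
  open import Data.List.Relation.Unary.AllPairs using (_∷_)
  open import Data.List.Relation.Unary.Unique.Propositional using (Unique)
  open import Data.List.Relation.Unary.Unique.Propositional.Properties
  open import Data.Product using (∃₂; ∃-syntax; _×_; _,_; proj₂)
  open import Data.Sum using (_⊎_; inj₁; inj₂)
  open import Data.Empty using (⊥-elim)
  open import Function using (_∘_; _⇔_; mk⇔; Equivalence)
  open import Relation.Binary.PropositionalEquality
  open import Relation.Nullary using (¬_; yes; no)
  open import Relation.Unary using (Decidable)

  open Equivalence

  infix 4 _∈ₛ_
  _∈ₛ_ : ∀ {n} → Fin n → Subset n → Set
  i ∈ₛ e = lookup e i ≡ true

  colour : ∀ {n N} → Vec (Fin N) n → Fin n → ℕ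
  colour f i = toℕ (lookup f i)

  HasUniqueMax : ∀ {n N} → Vec (Fin N) n → Subset n → Set
  HasUniqueMax f e = ∃[ i ] i ∈ₛ e × (∀ j → j ∈ₛ e → j ≢ i → colour f j < colour f i)

  HasTwoElements : ∀ {n} → Subset n → Set
  HasTwoElements e = ∃₂ λ i j → i ≢ j × i ∈ₛ e × j ∈ₛ e

  hasTwoElements⇒nonempty : ∀ {n} (e : Subset n) → HasTwoElements e → ∃[ i ] i ∈ₛ e
  hasTwoElements⇒nonempty e (i , _ , _ , i∈ , _) = i , i∈

  IsGood : ∀ {N} (G : HG) → Vec (Fin N) (n G) → Set
  IsGood G f = ∀ e → T (E G e) → HasTwoElements e → HasUniqueMax f e

  module _ {A : Set} {P : A → Set} (P? : Decidable P) where

    length-filter≡0⇒ : ∀ xs → length (filter P? xs) ≡ 0 → ∀ {x} → x ∈ xs → ¬ P x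
    length-filter≡0⇒ (x ∷ xs) eq x∈ Px with P? x
    length-filter≡0⇒ (x ∷ xs) () x∈ Px | yes _
    length-filter≡0⇒ (x ∷ xs) eq (here refl) Px | no ¬Px = ¬Px Px
    length-filter≡0⇒ (x ∷ xs) eq (there x∈) Px | no _   = length-filter≡0⇒ xs eq x∈ Px

    length-filter≡0⇐ : ∀ xs → (∀ {x} → x ∈ xs → ¬ P x) → length (filter P? xs) ≡ 0
    length-filter≡0⇐ []       none = refl
    length-filter≡0⇐ (x ∷ xs) none with P? x
    ... | yes Px = ⊥-elim (none (here refl) Px)
    ... | no _   = length-filter≡0⇐ xs (none ∘ there)

    length-filter≡1⇒ : ∀ xs → length (filter P? xs) ≡ 1 →
      ∃[ x ] x ∈ xs × P x × (∀ {y} → y ∈ xs → P y → y ≡ x)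
    length-filter≡1⇒ (x ∷ xs) eq with P? x
    ... | yes Px = x , here refl , Px ,
      λ { (here refl) _ → refl ; (there y∈) Py → ⊥-elim (length-filter≡0⇒ xs (suc-injective eq) y∈ Py) }
    ... | no ¬Px = let y , y∈ , Py , only = length-filter≡1⇒ xs eq in
      y , there y∈ , Py , λ { (here refl) Px → ⊥-elim (¬Px Px) ; (there z∈) Pz → only z∈ Pz }

    length-filter≡1⇐ : ∀ xs → Unique xs → ∀ {x} → x ∈ xs → P x → (∀ {y} → y ∈ xs → P y → y ≡ x) →
      length (filter P? xs) ≡ 1
    length-filter≡1⇐ (y ∷ xs) (y∉ ∷ u) x∈ Px only with P? y
    ... | yes Py = cong suc (length-filter≡0⇐ xs λ z∈ Pz →
      All.lookup y∉ z∈ (trans (only (here refl) Py) (sym (only (there z∈) Pz))))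
    length-filter≡1⇐ (y ∷ xs) (y∉ ∷ u) (here refl) Px only | no ¬Py = ⊥-elim (¬Py Px)
    length-filter≡1⇐ (y ∷ xs) (y∉ ∷ u) (there x∈) Px only | no _ =
      length-filter≡1⇐ xs u x∈ Px (only ∘ there)

  module _ {A : Set} (v : A → ℕ) where

    maxOf : List A → ℕ
    maxOf = foldr (λ x r → v x ⊔ r) 0

    maxOf-upperBound : ∀ xs {x} → x ∈ xs → v x ≤ maxOf xs
    maxOf-upperBound (x ∷ xs) (here refl) = m≤m⊔n (v x) _
    maxOf-upperBound (y ∷ xs) (there x∈)  = ≤-trans (maxOf-upperBound xs x∈) (m≤n⊔m (v y) _)

    maxOf-attained : ∀ xs {x} → x ∈ xs → ∃[ y ] y ∈ xs × v y ≡ maxOf xs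
    maxOf-attained (x ∷ []) (here refl) = x , here refl , sym (⊔-identityʳ (v x))
    maxOf-attained (x ∷ y ∷ xs) _ with maxOf-attained (y ∷ xs) (here refl) | v x ≤? maxOf (y ∷ xs)
    ... | z , z∈ , vz | yes vx≤ = z , there z∈ , trans vz (sym (m≤n⇒m⊔n≡n vx≤))
    ... | _ | no vx≰ = x , here refl , sym (m≥n⇒m⊔n≡m (≰⇒≥ vx≰))
    maxOf-attained (x ∷ []) (there ())

  ∈-members : ∀ {k} (e : Subset k) {i} → i ∈ₛ e → i ∈ members e
  ∈-members {k} e = ∈-filter⁺ (λ i → lookup e i Bool.≟ true) (∈-allFin _)

  members-∈ : ∀ {k} (e : Subset k) {i} → i ∈ members e → i ∈ₛ e
  members-∈ {k} e i∈ = proj₂ (∈-filter⁻ (λ i → lookup e i Bool.≟ true) {xs = allFin k} i∈)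

  members-unique : ∀ {k} (e : Subset k) → Unique (members e)
  members-unique {k} e = filter⁺ (λ i → lookup e i Bool.≟ true) (allFin⁺ k)

  uniqueMax⇔HasUniqueMax : ∀ {k N} (f : Vec (Fin N) k) (e : Subset k) → T (uniqueMax f e) ⇔ HasUniqueMax f e
  uniqueMax⇔HasUniqueMax {k} f e = mk⇔ ⇒ ⇐
    where
    mx = maxOf (colour f) (members e)
    isMax? : Decidable (λ i → colour f i ≡ mx)
    isMax? i = colour f i ≟ mx
    ⇒ : T (uniqueMax f e) → HasUniqueMax f e
    ⇒ um =
      let i , i∈ , i-max , only = length-filter≡1⇒ isMax? (members e) (≡ᵇ⇒≡ _ 1 um) in
      i , members-∈ e i∈ , λ j j∈ j≢i → subst (colour f j <_) (sym i-max)
        (≤∧≢⇒< (maxOf-upperBound (colour f) _ (∈-members e j∈)) (j≢i ∘ only (∈-members e j∈)))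
    ⇐ : HasUniqueMax f e → T (uniqueMax f e)
    ⇐ (i , i∈ₛ , i-max) = ≡⇒≡ᵇ _ 1 (length-filter≡1⇐ isMax? (members e) (members-unique e) i∈ i≡mx only)
      where
      i∈ = ∈-members e i∈ₛ
      i≡mx : colour f i ≡ mx
      i≡mx with maxOf-attained (colour f) (members e) i∈
      ... | j , j∈ , j≡mx with j Fin.≟ i
      ...   | yes refl = j≡mx
      ...   | no j≢i = ⊥-elim (<⇒≱ (i-max j (members-∈ e j∈) j≢i)
                         (subst (colour f i ≤_) (sym j≡mx) (maxOf-upperBound (colour f) _ i∈)))
      only : ∀ {j} → j ∈ members e → colour f j ≡ mx → j ≡ i
      only {j} j∈ j≡mx with j Fin.≟ i
      ... | yes j≡i = j≡i
      ... | no j≢i = ⊥-elim (<-irrefl (trans j≡mx (sym i≡mx)) (i-max j (members-∈ e j∈) j≢i))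

  private
    ∈ₛ⇒1≤size : ∀ {k} (s : Subset k) {j} → j ∈ₛ s → 1 ≤ size s
    ∈ₛ⇒1≤size (true ∷ s)  {zero}  _  = s≤s z≤n
    ∈ₛ⇒1≤size (true ∷ s)  {suc j} _  = s≤s z≤n
    ∈ₛ⇒1≤size (false ∷ s) {suc j} j∈ = ∈ₛ⇒1≤size s j∈

    1≤size⇒∈ₛ : ∀ {k} (s : Subset k) → 1 ≤ size s → ∃[ j ] j ∈ₛ s
    1≤size⇒∈ₛ (true ∷ s)  _ = zero , refl
    1≤size⇒∈ₛ (false ∷ s) h = let j , j∈ = 1≤size⇒∈ₛ s h in suc j , j∈

    size-∷ : ∀ b {k} (s : Subset k) → size s ≤ size (b ∷ s)
    size-∷ true  s = n≤1+n _
    size-∷ false s = ≤-refl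

  2≤size⇔HasTwoElements : ∀ {k} (s : Subset k) → 2 ≤ size s ⇔ HasTwoElements s
  2≤size⇔HasTwoElements s = mk⇔ (⇒ s) (⇐ s)
    where
    ⇒ : ∀ {k} (s : Subset k) → 2 ≤ size s → HasTwoElements s
    ⇒ (true ∷ s) (s≤s h) = let j , j∈ = 1≤size⇒∈ₛ s h in zero , suc j , (λ ()) , refl , j∈
    ⇒ (false ∷ s) h = let i , j , i≢j , i∈ , j∈ = ⇒ s h in
      suc i , suc j , i≢j ∘ Fin.suc-injective , i∈ , j∈
    ⇐ : ∀ {k} (s : Subset k) → HasTwoElements s → 2 ≤ size s
    ⇐ (b ∷ s)    (zero , zero , i≢j , _)            = ⊥-elim (i≢j refl)
    ⇐ (true ∷ s) (zero , suc j , _ , _ , j∈)        = s≤s (∈ₛ⇒1≤size s j∈)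
    ⇐ (true ∷ s) (suc i , zero , _ , i∈ , _)        = s≤s (∈ₛ⇒1≤size s i∈)
    ⇐ (b ∷ s)    (suc i , suc j , i≢j , i∈ , j∈)    =
      ≤-trans (⇐ s (i , j , i≢j ∘ cong suc , i∈ , j∈)) (size-∷ b s)

  subset-trichotomy : ∀ {k} (s : Subset k) →
    (∀ i → lookup s i ≡ false) ⊎ (∃[ i ] i ∈ₛ s × (∀ j → j ∈ₛ s → j ≡ i)) ⊎ HasTwoElements s
  subset-trichotomy [] = inj₁ λ ()
  subset-trichotomy (false ∷ s) with subset-trichotomy s
  ... | inj₁ none = inj₁ λ { zero → refl ; (suc i) → none i }
  ... | inj₂ (inj₁ (i , i∈ , only)) = inj₂ (inj₁ (suc i , i∈ , λ { (suc j) j∈ → cong suc (only j j∈) }))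
  ... | inj₂ (inj₂ (i , j , i≢j , i∈ , j∈)) = inj₂ (inj₂ (suc i , suc j , i≢j ∘ Fin.suc-injective , i∈ , j∈))
  subset-trichotomy (true ∷ s) with subset-trichotomy s
  ... | inj₁ none = inj₂ (inj₁ (zero , refl , λ
    { zero _ → refl ; (suc j) j∈ → ⊥-elim (true≢false (trans (sym j∈) (none j))) }))
    where true≢false : true ≢ false
          true≢false ()
  ... | inj₂ (inj₁ (i , i∈ , _)) = inj₂ (inj₂ (zero , suc i , (λ ()) , refl , i∈))
  ... | inj₂ (inj₂ (i , j , i≢j , i∈ , j∈)) = inj₂ (inj₂ (suc i , suc j , i≢j ∘ Fin.suc-injective , i∈ , j∈))

  ∈-allSubsets : ∀ {k} (e : Subset k) → e ∈ allSubsets k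
  ∈-allSubsets []          = here refl
  ∈-allSubsets (true ∷ e)  = ∈-++⁺ˡ (∈-map⁺ (true ∷_) (∈-allSubsets e))
  ∈-allSubsets {suc k} (false ∷ e) = ∈-++⁺ʳ (map (true ∷_) (allSubsets k)) (∈-map⁺ (false ∷_) (∈-allSubsets e))

  goodMap⇔IsGood : ∀ {N} (G : HG) (f : Vec (Fin N) (n G)) → T (goodMap G f) ⇔ IsGood G f
  goodMap⇔IsGood G f = mk⇔ ⇒ ⇐
    where
    ok : Subset (n G) → Bool
    ok e = not (E G e ∧ (2 ≤ᵇ size e)) ∨ uniqueMax f e
    ok⇒ : ∀ e → T (ok e) → T (E G e) → HasTwoElements e → HasUniqueMax f e
    ok⇒ e oke Ee two with E G e | 2 ≤ᵇ size e in big | uniqueMax f e in um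
    ... | true | true | true = to (uniqueMax⇔HasUniqueMax f e) (subst T (sym um) _)
    ... | true | false | _ = ⊥-elim (subst T big (≤⇒≤ᵇ (from (2≤size⇔HasTwoElements e) two)))
    ok⇐ : ∀ e → (T (E G e) → HasTwoElements e → HasUniqueMax f e) → T (ok e)
    ok⇐ e h with E G e | 2 ≤ᵇ size e in big | uniqueMax f e in um
    ... | false | _ | _ = _
    ... | true | false | _ = _
    ... | true | true | true = _
    ... | true | true | false = subst T um (from (uniqueMax⇔HasUniqueMax f e)
            (h _ (to (2≤size⇔HasTwoElements e) (≤ᵇ⇒≤ 2 (size e) (subst T (sym big) _)))))
    ⇒ : T (goodMap G f) → IsGood G f
    ⇒ good e = ok⇒ e (All.lookup (all⁺ ok _ good) (∈-allSubsets e))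
    ⇐ : IsGood G f → T (goodMap G f)
    ⇐ good = all⁻ ok {xs = allSubsets (n G)} (All.tabulate λ {e} _ → ok⇐ e (good e))

  eqSub⇔≡ : ∀ {k} (s t : Subset k) → T (eqSub s t) ⇔ s ≡ t
  eqSub⇔≡ s t = mk⇔ (⇒ s t) (λ { refl → ⇐ s })
    where
    ⇒ : ∀ {k} (s t : Subset k) → T (eqSub s t) → s ≡ t
    ⇒ [] [] _ = refl
    ⇒ (true ∷ s)  (true ∷ t)  eq = cong (true ∷_) (⇒ s t eq)
    ⇒ (false ∷ s) (false ∷ t) eq = cong (false ∷_) (⇒ s t eq)
    ⇐ : ∀ {k} (s : Subset k) → T (eqSub s s)
    ⇐ []          = _
    ⇐ (true ∷ s)  = ⇐ s
    ⇐ (false ∷ s) = ⇐ s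

  restrictCap-edge⇔ : ∀ (G : HG) (I : Subset (n G)) e′ →
    T (E (restrictCap G I) e′) ⇔ (∃[ e ] T (E G e) × compress I e ≡ e′)
  restrictCap-edge⇔ G I e′ = mk⇔ ⇒ ⇐
    where
    p : Subset (n G) → Bool
    p e = E G e ∧ eqSub (compress I e) e′
    ⇒ : T (E (restrictCap G I) e′) → ∃[ e ] T (E G e) × compress I e ≡ e′
    ⇒ h = let e , _ , pe = find (any⁻ p (allSubsets (n G)) h) ; Ee , eq = to T-∧ pe in
      e , Ee , to (eqSub⇔≡ _ _) eq
    ⇐ : (∃[ e ] T (E G e) × compress I e ≡ e′) → T (E (restrictCap G I) e′)
    ⇐ (e , Ee , eq) = any⁺ p (lose (∈-allSubsets e) (from T-∧ (Ee , from (eqSub⇔≡ _ _) eq)))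

module Restriction where
  open UniqueMaxima
  open import Data.Nat
  open import Data.Nat.Properties
  open import Data.Fin using (Fin)
  import Data.Fin as Fin
  open import Data.Fin.Subset using (Subset)
  open import Data.Vec using (Vec; lookup)
  open import Data.Product using (∃-syntax; _,_)
  open import Data.Sum using (_⊎_; inj₁; inj₂)
  open import Data.Empty using (⊥-elim)
  open import Function using (_∘_)
  open import Relation.Binary.PropositionalEquality
  open import Relation.Nullary using (yes; no)

  InImage : ∀ {k n} → (Fin k → Fin n) → Fin n → Set
  InImage ι i = ∃[ j ] ι j ≡ i

  Dominated : ∀ {k n N} → (Fin k → Fin n) → Vec (Fin N) n → Subset n → Set
  Dominated ι f e = ∀ i → i ∈ₛ e → InImage ι i ⊎ (∀ j → colour f i < colour f (ι j))

  module Along {k n N N′} (ι : Fin k → Fin n) (ι-injective : ∀ {j j′} → ι j ≡ ι j′ → j ≡ j′)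
           (g : Vec (Fin N) k) (f : Vec (Fin N′) n)
           (offset : ℕ) (colour-ι : ∀ j → colour f (ι j) ≡ offset + colour g j)
           (e′ : Subset k) (e : Subset n) (e′≗e∘ι : ∀ j → lookup e′ j ≡ lookup e (ι j)) where

    private
      ∈-along : ∀ {j} → j ∈ₛ e′ → ι j ∈ₛ e
      ∈-along {j} j∈ = trans (sym (e′≗e∘ι j)) j∈

      ∈-back : ∀ {j} → ι j ∈ₛ e → j ∈ₛ e′
      ∈-back {j} ιj∈ = trans (e′≗e∘ι j) ιj∈

      <-along : ∀ {j j′} → colour g j < colour g j′ → colour f (ι j) < colour f (ι j′)
      <-along {j} {j′} lt = subst₂ _<_ (sym (colour-ι j)) (sym (colour-ι j′)) (+-monoʳ-< offset lt)

      <-back : ∀ {j j′} → colour f (ι j) < colour f (ι j′) → colour g j < colour g j′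
      <-back {j} {j′} lt = +-cancelˡ-< offset _ _ (subst₂ _<_ (colour-ι j) (colour-ι j′) lt)

    hasTwoElements-along : HasTwoElements e′ → HasTwoElements e
    hasTwoElements-along (j , j′ , j≢j′ , j∈ , j′∈) =
      ι j , ι j′ , j≢j′ ∘ ι-injective , ∈-along j∈ , ∈-along j′∈

    hasTwoElements-back : (∀ i → i ∈ₛ e → InImage ι i) → HasTwoElements e → HasTwoElements e′
    hasTwoElements-back cover (i , i′ , i≢i′ , i∈ , i′∈) with cover i i∈ | cover i′ i′∈
    ... | j , refl | j′ , refl = j , j′ , i≢i′ ∘ cong ι , ∈-back i∈ , ∈-back i′∈

    hasUniqueMax-along : Dominated ι f e → HasUniqueMax g e′ → HasUniqueMax f e
    hasUniqueMax-along dominated (j₀ , j₀∈ , j₀-max) = ι j₀ , ∈-along j₀∈ , max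
      where
      max : ∀ i → i ∈ₛ e → i ≢ ι j₀ → colour f i < colour f (ι j₀)
      max i i∈ i≢ with dominated i i∈
      ... | inj₁ (j , refl) = <-along (j₀-max j (∈-back i∈) (i≢ ∘ cong ι))
      ... | inj₂ below      = below j₀

    hasUniqueMax-back : Dominated ι f e → ∃[ j ] j ∈ₛ e′ → HasUniqueMax f e → HasUniqueMax g e′
    hasUniqueMax-back dominated (j₁ , j₁∈) (i , i∈ , i-max) with dominated i i∈
    ... | inj₁ (j₀ , refl) =
      j₀ , ∈-back i∈ , λ j j∈ j≢j₀ → <-back (i-max (ι j) (∈-along j∈) (j≢j₀ ∘ ι-injective))
    ... | inj₂ below with ι j₁ Fin.≟ i
    ...   | yes refl = ⊥-elim (<-irrefl refl (below j₁))
    ...   | no ιj₁≢i = ⊥-elim (<-asym (below j₁) (i-max (ι j₁) (∈-along j₁∈) ιj₁≢i))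

module SubsetEmbedding where
  open UniqueMaxima using (_∈ₛ_)
  open Colourings using (merge)
  open import Data.Bool using (true; false)
  open import Data.Fin using (Fin; zero; suc; _↑ˡ_; _↑ʳ_)
  import Data.Fin.Properties as Fin
  open import Data.Fin.Subset using (Subset)
  open import Data.Vec using ([]; _∷_; lookup)
  open import Data.Product using (∃-syntax; _,_)
  open import Data.Sum using (_⊎_; inj₁; inj₂)
  open import Relation.Binary.PropositionalEquality

  embed : ∀ {n} (I : Subset n) → Fin (size I) → Fin n
  embed (true ∷ I)  zero    = zero
  embed (true ∷ I)  (suc k) = suc (embed I k)
  embed (false ∷ I) k       = suc (embed I k)

  embed-∈ₛ : ∀ {n} (I : Subset n) k → embed I k ∈ₛ I
  embed-∈ₛ (true ∷ I)  zero    = refl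
  embed-∈ₛ (true ∷ I)  (suc k) = embed-∈ₛ I k
  embed-∈ₛ (false ∷ I) k       = embed-∈ₛ I k

  embed-injective : ∀ {n} (I : Subset n) {k k′} → embed I k ≡ embed I k′ → k ≡ k′
  embed-injective (true ∷ I)  {zero}  {zero}   _  = refl
  embed-injective (true ∷ I)  {suc k} {suc k′} eq = cong suc (embed-injective I (Fin.suc-injective eq))
  embed-injective (false ∷ I) eq = embed-injective I (Fin.suc-injective eq)

  embed-surjective : ∀ {n} (I : Subset n) {i} → i ∈ₛ I → ∃[ k ] embed I k ≡ i
  embed-surjective (true ∷ I)  {zero}  _  = zero , refl
  embed-surjective (true ∷ I)  {suc i} i∈ = let k , eq = embed-surjective I i∈ in suc k , cong suc eq
  embed-surjective (false ∷ I) {suc i} i∈ = let k , eq = embed-surjective I i∈ in k , cong suc eq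

  embed-⊎ : ∀ {n} (I : Subset n) i → (∃[ k ] embed I k ≡ i) ⊎ (∃[ k ] embed (complement I) k ≡ i)
  embed-⊎ (true ∷ I)  zero    = inj₁ (zero , refl)
  embed-⊎ (false ∷ I) zero    = inj₂ (zero , refl)
  embed-⊎ (b ∷ I)     (suc i) with embed-⊎ I i | b
  ... | inj₁ (k , refl) | true  = inj₁ (suc k , refl)
  ... | inj₁ (k , refl) | false = inj₁ (k , refl)
  ... | inj₂ (k , refl) | true  = inj₂ (k , refl)
  ... | inj₂ (k , refl) | false = inj₂ (suc k , refl)

  lookup-compress : ∀ {n} (I : Subset n) e k → lookup (compress I e) k ≡ lookup e (embed I k)
  lookup-compress (true ∷ I)  (b ∷ e) zero    = refl
  lookup-compress (true ∷ I)  (b ∷ e) (suc k) = lookup-compress I e k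
  lookup-compress (false ∷ I) (b ∷ e) k       = lookup-compress I e k

  lookup-expand : ∀ {n} (I : Subset n) e′ k → lookup (expand I e′) (embed I k) ≡ lookup e′ k
  lookup-expand (true ∷ I)  (b ∷ e′) zero    = refl
  lookup-expand (true ∷ I)  (b ∷ e′) (suc k) = lookup-expand I e′ k
  lookup-expand (false ∷ I) e′       k       = lookup-expand I e′ k

  expand-⊆ : ∀ {n} (I : Subset n) e′ {i} → i ∈ₛ expand I e′ → i ∈ₛ I
  expand-⊆ (true ∷ I)  (b ∷ e′) {zero}  _  = refl
  expand-⊆ (true ∷ I)  (b ∷ e′) {suc i} i∈ = expand-⊆ I e′ i∈
  expand-⊆ (false ∷ I) e′       {suc i} i∈ = expand-⊆ I e′ i∈

  expand-compress : ∀ {n} (I : Subset n) e → (∀ {i} → i ∈ₛ e → i ∈ₛ I) → expand I (compress I e) ≡ e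
  expand-compress []          []          _   = refl
  expand-compress (true ∷ I)  (b ∷ e)     e⊆I = cong (b ∷_) (expand-compress I e λ {i} → e⊆I {suc i})
  expand-compress (false ∷ I) (true ∷ e)  e⊆I with e⊆I {zero} refl
  ... | ()
  expand-compress (false ∷ I) (false ∷ e) e⊆I = cong (false ∷_) (expand-compress I e λ {i} → e⊆I {suc i})

  lookup-merge-low : ∀ {n N M} (I : Subset n) a b k → lookup (merge {N = N} {M} I a b) (embed I k) ≡ lookup a k ↑ˡ M
  lookup-merge-low (true ∷ I)  (x ∷ a) b       zero    = refl
  lookup-merge-low (true ∷ I)  (x ∷ a) b       (suc k) = lookup-merge-low I a b k
  lookup-merge-low (false ∷ I) a       (y ∷ b) k       = lookup-merge-low I a b k

  lookup-merge-high : ∀ {n N M} (I : Subset n) a b k →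
    lookup (merge {N = N} {M} I a b) (embed (complement I) k) ≡ N ↑ʳ lookup b k
  lookup-merge-high (true ∷ I)  (x ∷ a) b       k       = lookup-merge-high I a b k
  lookup-merge-high (false ∷ I) a       (y ∷ b) zero    = refl
  lookup-merge-high (false ∷ I) a       (y ∷ b) (suc k) = lookup-merge-high I a b k

module GoodColourings where
  open UniqueMaxima
  open Restriction
  open SubsetEmbedding
  open Colourings using (merge)
  open import Data.Bool using (T; true; false; _∧_; _∨_)
  open import Data.Bool.Properties using (T-∧; T-∨)
  open import Data.Nat
  open import Data.Nat.Properties
  open import Data.Fin using (Fin; zero; suc; toℕ; _↑ˡ_; _↑ʳ_; splitAt)
  import Data.Fin.Properties as Fin
  open import Data.Fin.Subset using (Subset) renaming (⊥ to ∅)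
  open import Data.Fin.Permutation using (Permutation; _⟨$⟩ˡ_; _⟨$⟩ʳ_; inverseˡ; inverseʳ)
  open import Data.Vec using (Vec; []; _∷_; lookup; _++_; tabulate)
  import Data.Vec.Properties as Vec
  open import Data.Product using (∃-syntax; _×_; _,_)
  open import Data.Sum using (_⊎_; inj₁; inj₂)
  open import Data.Empty using (⊥-elim)
  open import Function using (_∘_; _⇔_; mk⇔; Equivalence)
  open import Relation.Binary.PropositionalEquality

  open Equivalence

  private
    true≢false : true ≢ false
    true≢false ()

  module _ (G : HG) (I : Subset (n G)) {N M}
           (a : Vec (Fin N) (size I)) (b : Vec (Fin M) (size (complement I))) where

    private
      Iᶜ = complement I
      f = merge I a b

      colour-low : ∀ k → colour f (embed I k) ≡ 0 + colour a k
      colour-low k = trans (cong toℕ (lookup-merge-low I a b k)) (Fin.toℕ-↑ˡ (lookup a k) M)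

      colour-high : ∀ k → colour f (embed Iᶜ k) ≡ N + colour b k
      colour-high k = trans (cong toℕ (lookup-merge-high I a b k)) (Fin.toℕ-↑ʳ N (lookup b k))

      module Low  = Along (embed I) (embed-injective I) a f 0 colour-low
      module High = Along (embed Iᶜ) (embed-injective Iᶜ) b f N colour-high

      high-dominated : ∀ e → Dominated (embed Iᶜ) f e
      high-dominated e i _ with embed-⊎ I i
      ... | inj₂ high          = inj₁ high
      ... | inj₁ (k′ , refl) = inj₂ λ k → subst₂ _<_ (sym (colour-low k′)) (sym (colour-high k))
        (<-≤-trans (Fin.toℕ<n (lookup a k′)) (m≤m+n N _))

      low-cover : ∀ e → (∀ {i} → i ∈ₛ e → i ∈ₛ I) → ∀ i → i ∈ₛ e → InImage (embed I) i
      low-cover e e⊆I i i∈ = embed-surjective I (e⊆I i∈)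

      no-high⇒⊆ : ∀ e → (∀ k → lookup (compress Iᶜ e) k ≡ false) → ∀ {i} → i ∈ₛ e → i ∈ₛ I
      no-high⇒⊆ e none {i} i∈ with embed-⊎ I i
      ... | inj₁ (k , refl) = embed-∈ₛ I k
      ... | inj₂ (k , refl) =
        ⊥-elim (true≢false (trans (sym i∈) (trans (sym (lookup-compress Iᶜ e k)) (none k))))

    isGood-merge⇔ : IsGood G (merge I a b) ⇔ (IsGood (restrictSub G I) a × IsGood (restrictCap G Iᶜ) b)
    isGood-merge⇔ = mk⇔ ⇒ ⇐
      where
      ⇒ : IsGood G f → IsGood (restrictSub G I) a × IsGood (restrictCap G Iᶜ) b
      ⇒ good = goodLow , goodHigh
        where
        goodLow : IsGood (restrictSub G I) a
        goodLow e′ Ee′ two =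
          Low.hasUniqueMax-back e′ (expand I e′) e′≗ (λ i i∈ → inj₁ (low-cover (expand I e′) (expand-⊆ I e′) i i∈))
            (hasTwoElements⇒nonempty e′ two) (good (expand I e′) Ee′ (Low.hasTwoElements-along e′ (expand I e′) e′≗ two))
          where
          e′≗ : ∀ k → lookup e′ k ≡ lookup (expand I e′) (embed I k)
          e′≗ k = sym (lookup-expand I e′ k)
        goodHigh : IsGood (restrictCap G Iᶜ) b
        goodHigh e′ Ee′ two with to (restrictCap-edge⇔ G Iᶜ e′) Ee′
        ... | e , Ee , refl = High.hasUniqueMax-back (compress Iᶜ e) e (lookup-compress Iᶜ e) (high-dominated e)
          (hasTwoElements⇒nonempty (compress Iᶜ e) two)
          (good e Ee (High.hasTwoElements-along (compress Iᶜ e) e (lookup-compress Iᶜ e) two))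
      ⇐ : IsGood (restrictSub G I) a × IsGood (restrictCap G Iᶜ) b → IsGood G f
      ⇐ (goodLow , goodHigh) e Ee two with subset-trichotomy (compress Iᶜ e)
      ... | inj₁ none =
        Low.hasUniqueMax-along (compress I e) e (lookup-compress I e) (λ i i∈ → inj₁ (low-cover e e⊆I i i∈))
          (goodLow (compress I e) (subst (T ∘ E G) (sym (expand-compress I e e⊆I)) Ee)
            (Low.hasTwoElements-back (compress I e) e (lookup-compress I e) (low-cover e e⊆I) two))
        where e⊆I = no-high⇒⊆ e none
      ... | inj₂ (inj₁ (k , k∈ , only)) =
        High.hasUniqueMax-along (compress Iᶜ e) e (lookup-compress Iᶜ e) (high-dominated e)
          (k , k∈ , λ j j∈ j≢k → ⊥-elim (j≢k (only j j∈)))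
      ... | inj₂ (inj₂ two′) =
        High.hasUniqueMax-along (compress Iᶜ e) e (lookup-compress Iᶜ e) (high-dominated e)
          (goodHigh (compress Iᶜ e) (from (restrictCap-edge⇔ G Iᶜ _) (e , Ee , refl)) two′)

  ↑ˡ⊎↑ʳ : ∀ n {m} (i : Fin (n + m)) → (∃[ j ] j ↑ˡ m ≡ i) ⊎ (∃[ j ] n ↑ʳ j ≡ i)
  ↑ˡ⊎↑ʳ n i with splitAt n i in eq
  ... | inj₁ j = inj₁ (j , Fin.splitAt⁻¹-↑ˡ eq)
  ... | inj₂ j = inj₂ (j , Fin.splitAt⁻¹-↑ʳ eq)

  private
    left-++ : ∀ {A : Set} n {m} (s : Vec A n) (t : Vec A m) → left n (s ++ t) ≡ s
    left-++ zero    []      t = refl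
    left-++ (suc n) (x ∷ s) t = cong (x ∷_) (left-++ n s t)

    right-++ : ∀ {A : Set} n {m} (s : Vec A n) (t : Vec A m) → right n (s ++ t) ≡ t
    right-++ zero    []      t = refl
    right-++ (suc n) (x ∷ s) t = right-++ n s t

    left++right : ∀ {A : Set} n {m} (v : Vec A (n + m)) → left n v ++ right n v ≡ v
    left++right zero    v       = refl
    left++right (suc n) (x ∷ v) = cong (x ∷_) (left++right n v)

    isEmpty-∅ : ∀ m → T (isEmpty (∅ {m}))
    isEmpty-∅ zero    = _
    isEmpty-∅ (suc m) = isEmpty-∅ m

    isEmpty⇒∉ : ∀ {m} (s : Subset m) → T (isEmpty s) → ∀ j → lookup s j ≡ false
    isEmpty⇒∉ (false ∷ s) h zero    = refl
    isEmpty⇒∉ (false ∷ s) h (suc j) = isEmpty⇒∉ s h j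

  module _ (G G′ : HG) {N} (a : Vec (Fin N) (n G)) (b : Vec (Fin N) (n G′)) where

    private
      n₁ = n G
      n₂ = n G′
      f = a ++ b

      module Left  = Along (_↑ˡ n₂) (Fin.↑ˡ-injective n₂ _ _) a f 0 (cong toℕ ∘ Vec.lookup-++ˡ a b)
      module Right = Along (n₁ ↑ʳ_) (Fin.↑ʳ-injective n₁ _ _) b f 0 (cong toℕ ∘ Vec.lookup-++ʳ a b)

      edge-++ : ∀ (s : Subset n₁) (t : Subset n₂) → E (G ⊎H G′) (s ++ t) ≡ (E G s ∧ isEmpty t) ∨ (isEmpty s ∧ E G′ t)
      edge-++ s t = cong₂ (λ s t → (E G s ∧ isEmpty t) ∨ (isEmpty s ∧ E G′ t)) (left-++ n₁ s t) (right-++ n₁ s t)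

      left-cover : ∀ (s : Subset n₁) (t : Subset n₂) → T (isEmpty t) → ∀ i → i ∈ₛ s ++ t → InImage (_↑ˡ n₂) i
      left-cover s t t-empty i i∈ with ↑ˡ⊎↑ʳ n₁ {n₂} i
      ... | inj₁ low = low
      ... | inj₂ (j , refl) = ⊥-elim (true≢false
        (trans (sym i∈) (trans (Vec.lookup-++ʳ s t j) (isEmpty⇒∉ t t-empty j))))

      right-cover : ∀ (s : Subset n₁) (t : Subset n₂) → T (isEmpty s) → ∀ i → i ∈ₛ s ++ t → InImage (n₁ ↑ʳ_) i
      right-cover s t s-empty i i∈ with ↑ˡ⊎↑ʳ n₁ {n₂} i
      ... | inj₂ high = high
      ... | inj₁ (j , refl) = ⊥-elim (true≢false
        (trans (sym i∈) (trans (Vec.lookup-++ˡ s t j) (isEmpty⇒∉ s s-empty j))))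

      good-++ : IsGood G a → IsGood G′ b → ∀ (s : Subset n₁) (t : Subset n₂) → T (E (G ⊎H G′) (s ++ t)) →
        HasTwoElements (s ++ t) → HasUniqueMax f (s ++ t)
      good-++ goodG goodG′ s t Est two with to T-∨ (subst T (edge-++ s t) Est)
      ... | inj₁ left-edge =
        let Es , t-empty = to T-∧ left-edge ; cover = left-cover s t t-empty in
        Left.hasUniqueMax-along s (s ++ t) (sym ∘ Vec.lookup-++ˡ s t) (λ i i∈ → inj₁ (cover i i∈))
          (goodG s Es (Left.hasTwoElements-back s (s ++ t) (sym ∘ Vec.lookup-++ˡ s t) cover two))
      ... | inj₂ right-edge =
        let s-empty , Et = to T-∧ right-edge ; cover = right-cover s t s-empty in
        Right.hasUniqueMax-along t (s ++ t) (sym ∘ Vec.lookup-++ʳ s t) (λ i i∈ → inj₁ (cover i i∈))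
          (goodG′ t Et (Right.hasTwoElements-back t (s ++ t) (sym ∘ Vec.lookup-++ʳ s t) cover two))

    isGood-++⇔ : IsGood (G ⊎H G′) (a ++ b) ⇔ (IsGood G a × IsGood G′ b)
    isGood-++⇔ = mk⇔ ⇒ ⇐
      where
      ⇒ : IsGood (G ⊎H G′) f → IsGood G a × IsGood G′ b
      ⇒ good = goodG , goodG′
        where
        goodG : IsGood G a
        goodG e Ee two = Left.hasUniqueMax-back e (e ++ ∅) (sym ∘ Vec.lookup-++ˡ e (∅ {n₂}))
          (λ i i∈ → inj₁ (left-cover e ∅ (isEmpty-∅ n₂) i i∈)) (hasTwoElements⇒nonempty e two)
          (good (e ++ ∅) (subst T (sym (edge-++ e ∅)) (from T-∨ (inj₁ (from T-∧ (Ee , isEmpty-∅ n₂)))))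
            (Left.hasTwoElements-along e (e ++ ∅) (sym ∘ Vec.lookup-++ˡ e (∅ {n₂})) two))
        goodG′ : IsGood G′ b
        goodG′ e Ee two = Right.hasUniqueMax-back e (∅ ++ e) (sym ∘ Vec.lookup-++ʳ (∅ {n₁}) e)
          (λ i i∈ → inj₁ (right-cover ∅ e (isEmpty-∅ n₁) i i∈)) (hasTwoElements⇒nonempty e two)
          (good (∅ ++ e) (subst T (sym (edge-++ ∅ e)) (from T-∨ (inj₂ (from T-∧ (isEmpty-∅ n₁ , Ee)))))
            (Right.hasTwoElements-along e (∅ ++ e) (sym ∘ Vec.lookup-++ʳ (∅ {n₁}) e) two))
      ⇐ : IsGood G a × IsGood G′ b → IsGood (G ⊎H G′) f
      ⇐ (goodG , goodG′) v Ev two = subst (HasUniqueMax f) (left++right n₁ v)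
        (good-++ goodG goodG′ (left n₁ v) (right n₁ v)
          (subst (T ∘ E (G ⊎H G′)) (sym (left++right n₁ v)) Ev)
          (subst HasTwoElements (sym (left++right n₁ v)) two))

  module _ {k k′} (σ : Permutation k k′) where

    relabel : ∀ {A : Set} → Vec A k → Vec A k′
    relabel v = tabulate (λ j → lookup v (σ ⟨$⟩ˡ j))

    unrelabel : ∀ {A : Set} → Vec A k′ → Vec A k
    unrelabel w = tabulate (λ i → lookup w (σ ⟨$⟩ʳ i))

    lookup-relabel : ∀ {A : Set} (v : Vec A k) j → lookup (relabel v) j ≡ lookup v (σ ⟨$⟩ˡ j)
    lookup-relabel v = Vec.lookup∘tabulate _

    unrelabel-relabel : ∀ {A : Set} (v : Vec A k) → unrelabel (relabel v) ≡ v
    unrelabel-relabel v = trans (Vec.tabulate-cong λ i →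
      trans (lookup-relabel v (σ ⟨$⟩ʳ i)) (cong (lookup v) (inverseˡ σ))) (Vec.tabulate∘lookup v)

    relabel-unrelabel : ∀ {A : Set} (w : Vec A k′) → relabel (unrelabel w) ≡ w
    relabel-unrelabel w = trans (Vec.tabulate-cong λ j →
      trans (Vec.lookup∘tabulate _ (σ ⟨$⟩ˡ j)) (cong (lookup w) (inverseʳ σ))) (Vec.tabulate∘lookup w)

  module _ (G G′ : HG) (σ : Permutation (n G) (n G′)) (edges : ∀ e → E G e ≡ E G′ (image σ e)) where

    private
      σˡ-injective : ∀ {j j′} → σ ⟨$⟩ˡ j ≡ σ ⟨$⟩ˡ j′ → j ≡ j′
      σˡ-injective eq = trans (sym (inverseʳ σ)) (trans (cong (σ ⟨$⟩ʳ_) eq) (inverseʳ σ))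

      σˡ-cover : ∀ i → InImage (σ ⟨$⟩ˡ_) i
      σˡ-cover i = σ ⟨$⟩ʳ i , inverseˡ σ

      module Relabelled {N} (f : Vec (Fin N) (n G)) =
        Along (σ ⟨$⟩ˡ_) σˡ-injective (relabel σ f) f 0 (λ j → cong toℕ (sym (lookup-relabel σ f j)))

    isGood-relabel⇔ : ∀ {N} (f : Vec (Fin N) (n G)) → IsGood G f ⇔ IsGood G′ (relabel σ f)
    isGood-relabel⇔ f = mk⇔ ⇒ ⇐
      where
      open Relabelled f
      ⇒ : IsGood G f → IsGood G′ (relabel σ f)
      ⇒ good e′ Ee′ two = subst (HasUniqueMax (relabel σ f)) (relabel-unrelabel σ e′)
        (hasUniqueMax-back (relabel σ e) e (lookup-relabel σ e) (λ i _ → inj₁ (σˡ-cover i))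
          (hasTwoElements⇒nonempty (relabel σ e) two′)
          (good e Ee (hasTwoElements-along (relabel σ e) e (lookup-relabel σ e) two′)))
        where
        e = unrelabel σ e′
        Ee : T (E G e)
        Ee = subst T (sym (edges e)) (subst (T ∘ E G′) (sym (relabel-unrelabel σ e′)) Ee′)
        two′ : HasTwoElements (relabel σ e)
        two′ = subst HasTwoElements (sym (relabel-unrelabel σ e′)) two
      ⇐ : IsGood G′ (relabel σ f) → IsGood G f
      ⇐ good e Ee two = hasUniqueMax-along (relabel σ e) e (lookup-relabel σ e) (λ i _ → inj₁ (σˡ-cover i))
        (good (relabel σ e) (subst T (edges e) Ee)
          (hasTwoElements-back (relabel σ e) e (lookup-relabel σ e) (λ i _ → σˡ-cover i) two))

module Counting where
  open Sums
  open Colourings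
  open UniqueMaxima using (goodMap⇔IsGood; IsGood)
  open GoodColourings
  open import Data.Bool using (Bool; T; true; false; _∧_)
  open import Data.Bool.Properties using (T-∧)
  open import Data.Nat
  open import Data.Nat.Properties
  open import Data.Vec using ([]; _++_)
  open import Data.Product using (_×_; _,_)
  open import Data.Product.Function.NonDependent.Propositional using (_×-⇔_)
  open import Data.Empty using (⊥-elim)
  open import Function using (_∘_; _⇔_; mk⇔; Equivalence)
  import Function.Properties.Equivalence as ⇔
  open import Relation.Binary.PropositionalEquality
  open ≡-Reasoning

  open Equivalence

  indicator-⇔ : ∀ {a b} → T a ⇔ T b → indicator a ≡ indicator b
  indicator-⇔ {true}  {true}  _   = refl
  indicator-⇔ {true}  {false} a⇔b = ⊥-elim (to a⇔b _)
  indicator-⇔ {false} {true}  a⇔b = ⊥-elim (from a⇔b _)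
  indicator-⇔ {false} {false} _   = refl

  indicator-∧ : ∀ a b → indicator (a ∧ b) ≡ indicator a * indicator b
  indicator-∧ true  true  = refl
  indicator-∧ true  false = refl
  indicator-∧ false b     = refl

  sumOver-indicator-× : ∀ {A B : Set} (r : A → B → Bool) (p : A → Bool) (q : B → Bool) xs ys →
    (∀ x y → T (r x y) ⇔ (T (p x) × T (q y))) →
    sumOver (λ x → sumOver (indicator ∘ r x) ys) xs ≡ sumOver (indicator ∘ p) xs * sumOver (indicator ∘ q) ys
  sumOver-indicator-× r p q xs ys r⇔p×q = begin
    sumOver (λ x → sumOver (indicator ∘ r x) ys) xs
      ≡⟨ sumOver-cong (λ x → sumOver-cong (λ y → indicator-⇔ (⇔.trans (r⇔p×q x y) (⇔.sym T-∧))) ys) xs ⟩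
    sumOver (λ x → sumOver (λ y → indicator (p x ∧ q y)) ys) xs
      ≡⟨ sumOver-cong (λ x → sumOver-cong (λ y → indicator-∧ (p x) (q y)) ys) xs ⟩
    sumOver (λ x → sumOver (λ y → indicator (p x) * indicator (q y)) ys) xs
      ≡⟨ sumOver-product (indicator ∘ p) (indicator ∘ q) xs ys ⟩
    sumOver (indicator ∘ p) xs * sumOver (indicator ∘ q) ys ∎

  countGood≡sumColourings : ∀ G N → countGood G N ≡ sumColourings (n G) N (indicator ∘ goodMap G)
  countGood≡sumColourings G N = length-filter (goodMap G) (allMaps (n G) N)

  countGood-+ : ∀ G N M → countGood G (N + M) ≡
    sumOver (λ I → countGood (restrictSub G I) N * countGood (restrictCap G (complement I)) M) (allSubsets (n G))
  countGood-+ G N M = begin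
    countGood G (N + M)
      ≡⟨ countGood≡sumColourings G (N + M) ⟩
    sumColourings (n G) (N + M) (indicator ∘ goodMap G)
      ≡⟨ sumColourings-merge (n G) N M _ ⟩
    sumOver (sumMerges N M (indicator ∘ goodMap G)) (allSubsets (n G))
      ≡⟨ sumOver-cong splitCount (allSubsets (n G)) ⟩
    sumOver (λ I → countGood (restrictSub G I) N * countGood (restrictCap G (complement I)) M) (allSubsets (n G)) ∎
    where
    splitCount : ∀ I → sumMerges N M (indicator ∘ goodMap G) I ≡
      countGood (restrictSub G I) N * countGood (restrictCap G (complement I)) M
    splitCount I = trans
      (sumOver-indicator-× (λ a b → goodMap G (merge I a b)) (goodMap (restrictSub G I)) (goodMap (restrictCap G (complement I)))
        (allMaps (size I) N) (allMaps (size (complement I)) M) λ a b →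
        ⇔.trans (goodMap⇔IsGood G (merge I a b)) (⇔.trans (isGood-merge⇔ G I a b)
          (⇔.sym (goodMap⇔IsGood (restrictSub G I) a ×-⇔ goodMap⇔IsGood (restrictCap G (complement I)) b))))
      (sym (cong₂ _*_ (countGood≡sumColourings (restrictSub G I) N)
                      (countGood≡sumColourings (restrictCap G (complement I)) M)))

  countGood-⊎H : ∀ G G′ N → countGood (G ⊎H G′) N ≡ countGood G N * countGood G′ N
  countGood-⊎H G G′ N = begin
    countGood (G ⊎H G′) N
      ≡⟨ countGood≡sumColourings (G ⊎H G′) N ⟩
    sumColourings (n G + n G′) N (indicator ∘ goodMap (G ⊎H G′))
      ≡⟨ sumColourings-++ (n G) (n G′) N _ ⟩
    sumColourings (n G) N (λ a → sumColourings (n G′) N (λ b → indicator (goodMap (G ⊎H G′) (a ++ b))))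
      ≡⟨ sumOver-indicator-× (λ a b → goodMap (G ⊎H G′) (a ++ b)) (goodMap G) (goodMap G′)
           (allMaps (n G) N) (allMaps (n G′) N) (λ a b →
           ⇔.trans (goodMap⇔IsGood (G ⊎H G′) (a ++ b)) (⇔.trans (isGood-++⇔ G G′ a b)
             (⇔.sym (goodMap⇔IsGood G a ×-⇔ goodMap⇔IsGood G′ b)))) ⟩
    sumColourings (n G) N (indicator ∘ goodMap G) * sumColourings (n G′) N (indicator ∘ goodMap G′)
      ≡⟨ cong₂ _*_ (countGood≡sumColourings G N) (countGood≡sumColourings G′ N) ⟨
    countGood G N * countGood G′ N ∎

  countGood-Iso : ∀ G G′ → Iso G G′ → ∀ N → countGood G N ≡ countGood G′ N
  countGood-Iso G G′ (σ , edges) N = begin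
    countGood G N
      ≡⟨ countGood≡sumColourings G N ⟩
    sumColourings (n G) N (indicator ∘ goodMap G)
      ≡⟨ sumColourings-cong (n G) N (λ f → indicator-⇔ (⇔.trans (goodMap⇔IsGood G f)
           (⇔.trans (isGood-relabel⇔ G G′ σ edges f) (⇔.sym (goodMap⇔IsGood G′ (relabel σ f)))))) ⟩
    sumColourings (n G) N (indicator ∘ goodMap G′ ∘ relabel σ)
      ≡⟨ sumColourings-reindex (relabel σ) (unrelabel σ) (unrelabel-relabel σ) (relabel-unrelabel σ) _ ⟨
    sumColourings (n G′) N (indicator ∘ goodMap G′)
      ≡⟨ countGood≡sumColourings G′ N ⟨
    countGood G′ N ∎

  countGood-noVertices : ∀ G → n G ≡ 0 → ∀ N → countGood G N ≡ 1
  countGood-noVertices (hg 0 E) refl N = begin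
    countGood (hg 0 E) N                        ≡⟨ countGood≡sumColourings (hg 0 E) N ⟩
    sumColourings 0 N (indicator ∘ goodMap (hg 0 E)) ≡⟨ sumColourings-[] N (indicator ∘ goodMap (hg 0 E)) ⟩
    indicator (goodMap {N} (hg 0 E) [])         ≡⟨ indicator-⇔ (⇔.trans (goodMap⇔IsGood {N} (hg 0 E) []) isGood) ⟩
    indicator true                              ∎
    where
    isGood : IsGood (hg 0 E) [] ⇔ T true
    isGood = mk⇔ _ λ { _ _ _ (() , _) }

  countGood-noColours : ∀ G → 1 ≤ n G → countGood G 0 ≡ 0
  countGood-noColours (hg (suc k) E) _ = refl

module BinomialCombinations where
  open Sums
  open import Data.Nat
  open import Data.Nat.Properties
  open import Data.Nat.Combinatorics using (_C_; nCk+nC[k+1]≡[n+1]C[k+1]; nC1≡n)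
  open import Data.Nat.Tactic.RingSolver using (solve-∀)
  open import Data.List using (List; []; _∷_; map) renaming (_++_ to _++ₗ_)
  open import Data.List.Membership.Propositional using (_∈_)
  open import Data.List.Relation.Unary.Any using (here; there)
  open import Data.Product using (∃-syntax; _×_; _,_)
  open import Function using (_∘_)
  open import Relation.Binary.PropositionalEquality
  open ≡-Reasoning

  evalTerms : List (ℕ × ℕ) → ℕ → ℕ
  evalTerms ts N = sumOver (λ { (c , k) → c * (N C k) }) ts

  IsBinomialCombination : (ℕ → ℕ) → Set
  IsBinomialCombination g = ∃[ ts ] ∀ N → g N ≡ evalTerms ts N

  private
    scale : ℕ → List (ℕ × ℕ) → List (ℕ × ℕ)
    scale a = map λ { (c , k) → (a * c , k) }

    shift : List (ℕ × ℕ) → List (ℕ × ℕ)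
    shift = map λ { (c , k) → (c , suc k) }

    evalTerms-scale : ∀ a ts N → evalTerms (scale a ts) N ≡ a * evalTerms ts N
    evalTerms-scale a ts N = trans (sumOver-map _ _ ts)
      (trans (sumOver-cong (λ { (c , k) → *-assoc a c (N C k) }) ts) (*-distribˡ-sumOver a _ ts))

    evalTerms-shift-zero : ∀ ts → evalTerms (shift ts) 0 ≡ 0
    evalTerms-shift-zero ts = trans (sumOver-map _ _ ts)
      (trans (sumOver-cong (λ { (c , k) → *-zeroʳ c }) ts) (sumOver-zero ts))

    evalTerms-shift-suc : ∀ ts N → evalTerms (shift ts) (suc N) ≡ evalTerms (shift ts) N + evalTerms ts N
    evalTerms-shift-suc ts N = begin
      evalTerms (shift ts) (suc N)
        ≡⟨ sumOver-map _ _ ts ⟩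
      sumOver (λ { (c , k) → c * (suc N C suc k) }) ts
        ≡⟨ sumOver-cong (λ { (c , k) → pascal c k }) ts ⟩
      sumOver (λ { (c , k) → c * (N C suc k) + c * (N C k) }) ts
        ≡⟨ sumOver-distrib-+ _ _ ts ⟩
      sumOver (λ { (c , k) → c * (N C suc k) }) ts + evalTerms ts N
        ≡⟨ cong (_+ evalTerms ts N) (sumOver-map _ _ ts) ⟨
      evalTerms (shift ts) N + evalTerms ts N ∎
      where
      pascal : ∀ c k → c * (suc N C suc k) ≡ c * (N C suc k) + c * (N C k)
      pascal c k = trans (cong (c *_) (trans (sym (nCk+nC[k+1]≡[n+1]C[k+1] N k)) (+-comm (N C k) _)))
        (*-distribˡ-+ c (N C suc k) (N C k))

  isBinomialCombination-sumOver : ∀ {A : Set} (F : A → ℕ → ℕ) (a : A → ℕ) xs →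
    (∀ {x} → x ∈ xs → IsBinomialCombination (F x)) →
    IsBinomialCombination (λ N → sumOver (λ x → F x N * a x) xs)
  isBinomialCombination-sumOver F a []       _     = [] , λ _ → refl
  isBinomialCombination-sumOver F a (x ∷ xs) combs =
    let ts , Fx≡ = combs (here refl) ; us , rest≡ = isBinomialCombination-sumOver F a xs (combs ∘ there) in
    scale (a x) ts ++ₗ us , λ N → begin
      F x N * a x + sumOver (λ x → F x N * a x) xs
        ≡⟨ cong₂ _+_ (trans (*-comm (F x N) (a x)) (cong (a x *_) (Fx≡ N))) (rest≡ N) ⟩
      a x * evalTerms ts N + evalTerms us N      ≡⟨ cong (_+ evalTerms us N) (evalTerms-scale (a x) ts N) ⟨
      evalTerms (scale (a x) ts) N + evalTerms us N ≡⟨ sumOver-++ _ (scale (a x) ts) us ⟨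
      evalTerms (scale (a x) ts ++ₗ us) N         ∎

  isBinomialCombination-summation : ∀ (g d : ℕ → ℕ) → (∀ N → g (suc N) ≡ g N + d N) →
    IsBinomialCombination d → IsBinomialCombination g
  isBinomialCombination-summation g d step (ts , d≡) = (g 0 , 0) ∷ shift ts , g≡
    where
    g≡ : ∀ N → g N ≡ evalTerms ((g 0 , 0) ∷ shift ts) N
    g≡ zero    = sym (trans (cong (g 0 * 1 +_) (evalTerms-shift-zero ts)) (trans (+-identityʳ _) (*-identityʳ _)))
    g≡ (suc N) = begin
      g (suc N)                                                   ≡⟨ step N ⟩
      g N + d N                                                   ≡⟨ cong₂ _+_ (g≡ N) (d≡ N) ⟩
      g 0 * 1 + evalTerms (shift ts) N + evalTerms ts N           ≡⟨ +-assoc (g 0 * 1) _ _ ⟩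
      g 0 * 1 + (evalTerms (shift ts) N + evalTerms ts N)         ≡⟨ cong (g 0 * 1 +_) (evalTerms-shift-suc ts N) ⟨
      g 0 * 1 + evalTerms (shift ts) (suc N)                      ∎

  binomial-absorption : ∀ N k → suc k * (N C suc k) + k * (N C k) ≡ N * (N C k)
  binomial-absorption zero    zero    = refl
  binomial-absorption zero    (suc k) = cong₂ _+_ (*-zeroʳ (suc (suc k))) (*-zeroʳ (suc k))
  binomial-absorption (suc N) zero    =
    trans (+-identityʳ _) (trans (*-identityˡ _) (trans (nC1≡n (suc N)) (sym (*-identityʳ (suc N)))))
  binomial-absorption (suc N) (suc j) = begin
    suc (suc j) * (suc N C suc (suc j)) + suc j * (suc N C suc j)
      ≡⟨ cong₂ (λ u v → suc (suc j) * u + suc j * v) (pascal (suc j)) (pascal j) ⟩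
    suc (suc j) * (b + c) + suc j * (a + b)         ≡⟨ rearrange₁ j a b c ⟩
    suc (suc j) * b + (suc (suc j) * c + suc j * b) + suc j * a
      ≡⟨ cong (λ z → suc (suc j) * b + z + suc j * a) (binomial-absorption N (suc j)) ⟩
    suc (suc j) * b + N * b + suc j * a             ≡⟨ rearrange₂ j a b N ⟩
    a + b + (suc j * b + j * a) + N * b             ≡⟨ cong (λ z → a + b + z + N * b) (binomial-absorption N j) ⟩
    a + b + N * a + N * b                           ≡⟨ rearrange₃ a b N ⟩
    suc N * (a + b)                                 ≡⟨ cong (suc N *_) (pascal j) ⟨
    suc N * (suc N C suc j)                         ∎
    where
    a = N C j
    b = N C suc j
    c = N C suc (suc j)
    pascal : ∀ k → suc N C suc k ≡ N C k + N C suc k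
    pascal k = sym (nCk+nC[k+1]≡[n+1]C[k+1] N k)
    rearrange₁ : ∀ j a b c → suc (suc j) * (b + c) + suc j * (a + b) ≡ suc (suc j) * b + (suc (suc j) * c + suc j * b) + suc j * a
    rearrange₁ = solve-∀
    rearrange₂ : ∀ j a b N → suc (suc j) * b + N * b + suc j * a ≡ a + b + (suc j * b + j * a) + N * b
    rearrange₂ = solve-∀
    rearrange₃ : ∀ a b N → a + b + N * a + N * b ≡ suc N * (a + b)
    rearrange₃ = solve-∀

module CountPolynomiality where
  open Sums
  open Counting
  open BinomialCombinations
  open import Data.Bool using (true; false)
  open import Data.Nat
  open import Data.Nat.Properties
  open import Data.Nat.Induction using (<-rec)
  open import Data.Fin.Subset using (Subset; ⊤)
  open import Data.Vec using ([]; _∷_)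
  open import Data.List using (List; []; _∷_; map) renaming (_++_ to _++ₗ_)
  open import Data.List.Membership.Propositional using (_∈_)
  open import Data.List.Membership.Propositional.Properties using (∈-++⁻; ∈-map⁻)
  open import Data.Product using (∃-syntax; _×_; _,_; proj₁; proj₂)
  open import Data.Sum using (inj₁; inj₂)
  open import Relation.Binary.PropositionalEquality
  open ≡-Reasoning

  size+size-complement : ∀ {k} (I : Subset k) → size I + size (complement I) ≡ k
  size+size-complement []          = refl
  size+size-complement (true ∷ I)  = cong suc (size+size-complement I)
  size+size-complement (false ∷ I) = trans (+-suc (size I) _) (cong suc (size+size-complement I))

  size-complement-⊤ : ∀ k → size (complement (⊤ {k})) ≡ 0
  size-complement-⊤ zero    = refl
  size-complement-⊤ (suc k) = size-complement-⊤ k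

  allSubsets≡⊤∷proper : ∀ k → ∃[ proper ] allSubsets k ≡ ⊤ ∷ proper × (∀ {I} → I ∈ proper → size I < k)
  allSubsets≡⊤∷proper zero    = [] , refl , λ ()
  allSubsets≡⊤∷proper (suc k) with allSubsets≡⊤∷proper k
  ... | proper , eq , small =
    map (true ∷_) proper ++ₗ map (false ∷_) (allSubsets k) ,
    cong (λ Is → map (true ∷_) Is ++ₗ map (false ∷_) (allSubsets k)) eq , small′
    where
    small′ : ∀ {I} → I ∈ map (true ∷_) proper ++ₗ map (false ∷_) (allSubsets k) → size I < suc k
    small′ I∈ with ∈-++⁻ (map (true ∷_) proper) I∈
    ... | inj₁ I∈′ with ∈-map⁻ (true ∷_) I∈′
    ...   | J , J∈ , refl = s≤s (small J∈)
    small′ I∈ | inj₂ I∈′ with ∈-map⁻ (false ∷_) I∈′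
    ...   | J , _ , refl = s≤s (subst (size J ≤_) (size+size-complement J) (m≤m+n _ _))

  module _ (G : HG) where

    private
      k = n G
      proper : List (Subset k)
      proper = proj₁ (allSubsets≡⊤∷proper k)

      allSubsets≡ : allSubsets k ≡ ⊤ ∷ proper
      allSubsets≡ = proj₁ (proj₂ (allSubsets≡⊤∷proper k))

      proper-small : ∀ {I} → I ∈ proper → size I < k
      proper-small = proj₂ (proj₂ (allSubsets≡⊤∷proper k))

      low : Subset k → ℕ → ℕ
      low I N = countGood (restrictSub G I) N

      high : Subset k → ℕ → ℕ
      high I M = countGood (restrictCap G (complement I)) M

      countGood-+′ : ∀ N M → countGood G (N + M) ≡ low ⊤ N * high ⊤ M + sumOver (λ I → low I N * high I M) proper
      countGood-+′ N M = trans (countGood-+ G N M) (cong (sumOver (λ I → low I N * high I M)) allSubsets≡)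

      high-⊤ : ∀ M → high ⊤ M ≡ 1
      high-⊤ = countGood-noVertices (restrictCap G (complement ⊤)) (size-complement-⊤ k)

      high-proper-0 : ∀ {I} → I ∈ proper → high I 0 ≡ 0
      high-proper-0 {I} I∈ = countGood-noColours (restrictCap G (complement I)) (+-cancelˡ-< (size I) 0 _
        (subst₂ _<_ (sym (+-identityʳ (size I))) (sym (size+size-complement I)) (proper-small I∈)))

    -- M = 0 in the splitting formula: only I = V(G) survives.
    countGood-restrictSub-⊤ : ∀ N → countGood (restrictSub G ⊤) N ≡ countGood G N
    countGood-restrictSub-⊤ N = sym (begin
      countGood G N                                                ≡⟨ cong (countGood G) (+-identityʳ N) ⟨
      countGood G (N + 0)                                          ≡⟨ countGood-+′ N 0 ⟩
      low ⊤ N * high ⊤ 0 + sumOver (λ I → low I N * high I 0) proper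
        ≡⟨ cong₂ _+_ (trans (cong (low ⊤ N *_) (high-⊤ 0)) (*-identityʳ _))
                     (trans (sumOver-cong-∈ proper λ {I} I∈ →
                              trans (cong (low I N *_) (high-proper-0 I∈)) (*-zeroʳ (low I N)))
                            (sumOver-zero proper)) ⟩
      low ⊤ N + 0                                                  ≡⟨ +-identityʳ _ ⟩
      low ⊤ N                                                      ∎)

    countGood-suc : ∀ N → countGood G (suc N) ≡ countGood G N + sumOver (λ I → low I N * high I 1) proper
    countGood-suc N = begin
      countGood G (suc N)                                                ≡⟨ cong (countGood G) (+-comm 1 N) ⟩
      countGood G (N + 1)                                                ≡⟨ countGood-+′ N 1 ⟩
      low ⊤ N * high ⊤ 1 + sumOver (λ I → low I N * high I 1) proper
        ≡⟨ cong (_+ sumOver (λ I → low I N * high I 1) proper)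
             (trans (cong (low ⊤ N *_) (high-⊤ 1)) (trans (*-identityʳ _) (countGood-restrictSub-⊤ N))) ⟩
      countGood G N + sumOver (λ I → low I N * high I 1) proper          ∎

    countGood-isBinomialCombination-step :
      (∀ {j} → j < n G → ∀ E → IsBinomialCombination (countGood (hg j E))) → IsBinomialCombination (countGood G)
    countGood-isBinomialCombination-step smaller =
      isBinomialCombination-summation (countGood G) _ countGood-suc
        (isBinomialCombination-sumOver low (λ I → high I 1) proper λ {I} I∈ → smaller (proper-small I∈) (E (restrictSub G I)))

  countGood-isBinomialCombination : ∀ G → IsBinomialCombination (countGood G)
  countGood-isBinomialCombination (hg k E) =
    <-rec (λ k → ∀ E → IsBinomialCombination (countGood (hg k E)))
      (λ k smaller E → countGood-isBinomialCombination-step (hg k E) smaller) k E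

-- Coefficients are pairs (a , b) read as a·1 − b·1, so that the solver works in rings
-- whose equality is undecidable: constants are compared as pairs of naturals.
module CommutativeRingSolver {c ℓ} (R : CommutativeRing c ℓ) where
  open import Level using (0ℓ)
  open import Data.Nat as ℕ using (ℕ; zero; suc)
  import Data.Nat.Properties as ℕ
  open import Data.Product using (_×_; _,_)
  import Data.Product.Properties as Product
  open import Data.Maybe using (Maybe; just; nothing)
  import Relation.Binary.PropositionalEquality as ≡
  open import Relation.Nullary using (yes; no)
  open import Algebra.Bundles.Raw using (RawRing)
  import Algebra.Solver.Ring.AlmostCommutativeRing as ACR
  import Algebra.Solver.CommutativeMonoid as MonoidSolver

  open CommutativeRing R
  open import Algebra.Properties.Ring ring using (-‿+-comm; -‿involutive; -‿distribˡ-*; -‿distribʳ-*)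
  open import Algebra.Properties.Semiring.Mult semiring using (×-homo-+; ×1-homo-*) renaming (_×_ to _×ᵣ_)
  open import Relation.Binary.Reasoning.Setoid setoid
  open MonoidSolver +-commutativeMonoid using (_⊕_) renaming (solve to +-solve; _⊜_ to _⊜⁺_)

  private
    reduce : ℕ × ℕ → ℕ × ℕ
    reduce (suc a , suc b) = reduce (a , b)
    reduce p               = p

    Differences : RawRing 0ℓ 0ℓ
    Differences = record
      { Carrier = ℕ × ℕ ; _≈_ = ≡._≡_
      ; _+_ = λ { (a , b) (a′ , b′) → reduce (a ℕ.+ a′ , b ℕ.+ b′) }
      ; _*_ = λ { (a , b) (a′ , b′) → reduce (a ℕ.* a′ ℕ.+ b ℕ.* b′ , a ℕ.* b′ ℕ.+ b ℕ.* a′) }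
      ; -_ = λ { (a , b) → (b , a) }
      ; 0# = (0 , 0) ; 1# = (1 , 0) }

    ⟦_⟧ : ℕ × ℕ → Carrier
    ⟦ a , b ⟧ = a ×ᵣ 1# + - (b ×ᵣ 1#)

    ⟦reduce⟧ : ∀ p → ⟦ reduce p ⟧ ≈ ⟦ p ⟧
    ⟦reduce⟧ (zero  , b)     = refl
    ⟦reduce⟧ (suc a , zero)  = refl
    ⟦reduce⟧ (suc a , suc b) = trans (⟦reduce⟧ (a , b)) (sym (begin
      (1# + a ×ᵣ 1#) + - (1# + b ×ᵣ 1#)      ≈⟨ +-congˡ (sym (-‿+-comm 1# (b ×ᵣ 1#))) ⟩
      (1# + a ×ᵣ 1#) + (- 1# + - (b ×ᵣ 1#))
        ≈⟨ +-solve 4 (λ x y o m → (o ⊕ x) ⊕ (m ⊕ y) ⊜⁺ (o ⊕ m) ⊕ (x ⊕ y)) refl _ _ _ _ ⟩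
      (1# + - 1#) + ⟦ a , b ⟧              ≈⟨ +-congʳ (-‿inverseʳ 1#) ⟩
      0# + ⟦ a , b ⟧                       ≈⟨ +-identityˡ _ ⟩
      ⟦ a , b ⟧                            ∎))

    -x*-y≈x*y : ∀ x y → (- x) * (- y) ≈ x * y
    -x*-y≈x*y x y = trans (sym (-‿distribˡ-* x (- y))) (trans (-‿cong (sym (-‿distribʳ-* x y))) (-‿involutive _))

    ⟦⟧-homo-* : ∀ a b a′ b′ →
      ⟦ reduce (a ℕ.* a′ ℕ.+ b ℕ.* b′ , a ℕ.* b′ ℕ.+ b ℕ.* a′) ⟧ ≈ ⟦ a , b ⟧ * ⟦ a′ , b′ ⟧
    ⟦⟧-homo-* a b a′ b′ = begin
        ⟦ reduce (a ℕ.* a′ ℕ.+ b ℕ.* b′ , a ℕ.* b′ ℕ.+ b ℕ.* a′) ⟧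
          ≈⟨ ⟦reduce⟧ (a ℕ.* a′ ℕ.+ b ℕ.* b′ , a ℕ.* b′ ℕ.+ b ℕ.* a′) ⟩
        (a ℕ.* a′ ℕ.+ b ℕ.* b′) ×ᵣ 1# + - ((a ℕ.* b′ ℕ.+ b ℕ.* a′) ×ᵣ 1#)
          ≈⟨ +-cong (trans (×-homo-+ 1# (a ℕ.* a′) (b ℕ.* b′)) (+-cong (×1-homo-* a a′) (×1-homo-* b b′)))
               (-‿cong (trans (×-homo-+ 1# (a ℕ.* b′) (b ℕ.* a′)) (+-cong (×1-homo-* a b′) (×1-homo-* b a′)))) ⟩
        (A * A′ + B * B′) + - (A * B′ + B * A′)             ≈⟨ +-congˡ (sym (-‿+-comm _ _)) ⟩
        (A * A′ + B * B′) + (- (A * B′) + - (B * A′))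
          ≈⟨ +-solve 4 (λ p q r s → (p ⊕ q) ⊕ (r ⊕ s) ⊜⁺ (p ⊕ r) ⊕ (s ⊕ q)) refl _ _ _ _ ⟩
        (A * A′ + - (A * B′)) + (- (B * A′) + B * B′)
          ≈⟨ +-cong (+-congˡ (-‿distribʳ-* _ _)) (+-cong (-‿distribˡ-* _ _) (sym (-x*-y≈x*y _ _))) ⟩
        (A * A′ + A * - B′) + (- B * A′ + - B * - B′)       ≈⟨ sym (+-cong (distribˡ _ _ _) (distribˡ _ _ _)) ⟩
        A * ⟦ a′ , b′ ⟧ + - B * ⟦ a′ , b′ ⟧                 ≈⟨ sym (distribʳ _ _ _) ⟩
        ⟦ a , b ⟧ * ⟦ a′ , b′ ⟧                             ∎
      where
      A = a ×ᵣ 1# ; B = b ×ᵣ 1# ; A′ = a′ ×ᵣ 1# ; B′ = b′ ×ᵣ 1#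

    homomorphism : Differences ACR.-Raw-AlmostCommutative⟶ ACR.fromCommutativeRing R
    homomorphism = record
      { ⟦_⟧    = ⟦_⟧
      ; +-homo = λ { (a , b) (a′ , b′) → begin
          ⟦ reduce (a ℕ.+ a′ , b ℕ.+ b′) ⟧                    ≈⟨ ⟦reduce⟧ (a ℕ.+ a′ , b ℕ.+ b′) ⟩
          (a ℕ.+ a′) ×ᵣ 1# + - ((b ℕ.+ b′) ×ᵣ 1#)
            ≈⟨ +-cong (×-homo-+ 1# a a′) (-‿cong (×-homo-+ 1# b b′)) ⟩
          (a ×ᵣ 1# + a′ ×ᵣ 1#) + - (b ×ᵣ 1# + b′ ×ᵣ 1#)           ≈⟨ +-congˡ (sym (-‿+-comm _ _)) ⟩
          (a ×ᵣ 1# + a′ ×ᵣ 1#) + (- (b ×ᵣ 1#) + - (b′ ×ᵣ 1#))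
            ≈⟨ +-solve 4 (λ x y z w → (x ⊕ y) ⊕ (z ⊕ w) ⊜⁺ (x ⊕ z) ⊕ (y ⊕ w)) refl _ _ _ _ ⟩
          ⟦ a , b ⟧ + ⟦ a′ , b′ ⟧ ∎ }
      ; *-homo = λ { (a , b) (a′ , b′) → ⟦⟧-homo-* a b a′ b′ }
      ; -‿homo = λ { (a , b) → trans (+-comm _ _) (trans (+-congˡ (sym (-‿involutive _))) (-‿+-comm _ _)) }
      ; 0-homo = -‿inverseʳ 0#
      ; 1-homo = trans (+-assoc _ _ _) (trans (+-congˡ (-‿inverseʳ 0#)) (+-identityʳ 1#))
      }

    reduced≟ : ∀ p q → Maybe (⟦ p ⟧ ≈ ⟦ q ⟧)
    reduced≟ p q with Product.≡-dec ℕ._≟_ ℕ._≟_ p q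
    ... | yes ≡.refl = just refl
    ... | no _       = nothing

  open import Algebra.Solver.Ring Differences (ACR.fromCommutativeRing R) homomorphism reduced≟ public
    using (solve; _:=_; _:+_; _:*_; :-_)

module PolynomialEvaluation {c ℓ} (K : Field c ℓ) where
  open import Data.Nat as ℕ using (ℕ; zero; suc)
  open import Data.List using ([]; _∷_; map)
  import Relation.Binary.PropositionalEquality as ≡
  open Field K
  open import Algebra.Properties.Semiring.Mult semiring using (×-homo-+; ×1-homo-*) renaming (_×_ to _×ᵣ_)
  open import Relation.Binary.Reasoning.Setoid setoid
  open CommutativeRingSolver commutativeRing

  ι≡× : ∀ n → ι K n ≡.≡ n ×ᵣ 1#
  ι≡× zero    = ≡.refl
  ι≡× (suc n) = ≡.cong (1# +_) (ι≡× n)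

  ι-+ : ∀ m n → ι K (m ℕ.+ n) ≈ ι K m + ι K n
  ι-+ m n rewrite ι≡× (m ℕ.+ n) | ι≡× m | ι≡× n = ×-homo-+ 1# m n

  ι-* : ∀ m n → ι K (m ℕ.* n) ≈ ι K m * ι K n
  ι-* m n rewrite ι≡× (m ℕ.* n) | ι≡× m | ι≡× n = ×1-homo-* m n

  eval-cong : ∀ p {x y} → x ≈ y → eval K p x ≈ eval K p y
  eval-cong []      x≈y = refl
  eval-cong (a ∷ p) x≈y = +-congˡ (*-cong x≈y (eval-cong p x≈y))

  eval-+P : ∀ p q x → eval K (_+P_ K p q) x ≈ eval K p x + eval K q x
  eval-+P []      q       x = sym (+-identityˡ _)
  eval-+P (a ∷ p) []      x = sym (+-identityʳ _)
  eval-+P (a ∷ p) (b ∷ q) x = begin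
    (a + b) + x * eval K (_+P_ K p q) x          ≈⟨ +-congˡ (*-congˡ (eval-+P p q x)) ⟩
    (a + b) + x * (eval K p x + eval K q x)
      ≈⟨ solve 5 (λ a b x u v → (a :+ b) :+ x :* (u :+ v) := (a :+ x :* u) :+ (b :+ x :* v)) refl a b x _ _ ⟩
    (a + x * eval K p x) + (b + x * eval K q x) ∎

  eval-·P : ∀ a p x → eval K (_·P_ K a p) x ≈ a * eval K p x
  eval-·P a []      x = sym (zeroʳ a)
  eval-·P a (b ∷ p) x = begin
    a * b + x * eval K (_·P_ K a p) x ≈⟨ +-congˡ (*-congˡ (eval-·P a p x)) ⟩
    a * b + x * (a * eval K p x)     ≈⟨ solve 4 (λ a b x u → a :* b :+ x :* (a :* u) := a :* (b :+ x :* u)) refl a b x _ ⟩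
    a * (b + x * eval K p x)         ∎

  eval-*P : ∀ p q x → eval K (_*P_ K p q) x ≈ eval K p x * eval K q x
  eval-*P []      q x = sym (zeroˡ _)
  eval-*P (a ∷ p) q x = begin
    eval K (_+P_ K (_·P_ K a q) (0# ∷ _*P_ K p q)) x         ≈⟨ eval-+P (_·P_ K a q) _ x ⟩
    eval K (_·P_ K a q) x + (0# + x * eval K (_*P_ K p q) x)  ≈⟨ +-cong (eval-·P a q x) (+-congˡ (*-congˡ (eval-*P p q x))) ⟩
    a * eval K q x + (0# + x * (eval K p x * eval K q x))   ≈⟨ +-congˡ (+-identityˡ _) ⟩
    a * eval K q x + x * (eval K p x * eval K q x)
      ≈⟨ solve 4 (λ a x u v → a :* v :+ x :* (u :* v) := (a :+ x :* u) :* v) refl a x _ _ ⟩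
    (a + x * eval K p x) * eval K q x                        ∎

  eval-1P : ∀ x → eval K (1P K) x ≈ 1#
  eval-1P x = trans (+-congˡ (zeroʳ x)) (+-identityʳ 1#)

  -P_ : Poly K → Poly K
  -P_ = map (λ a → - a)

  eval--P : ∀ p x → eval K (-P p) x ≈ - eval K p x
  eval--P []      x = sym (trans (sym (+-identityˡ _)) (-‿inverseʳ 0#))
  eval--P (a ∷ p) x = begin
    - a + x * eval K (-P p) x  ≈⟨ +-congˡ (*-congˡ (eval--P p x)) ⟩
    - a + x * - eval K p x     ≈⟨ solve 3 (λ a x u → :- a :+ x :* :- u := :- (a :+ x :* u)) refl a x _ ⟩
    - (a + x * eval K p x)     ∎

module PolynomialIdentity {c ℓ} (K : Field c ℓ) (charZero : CharZero K) where
  open import Data.Nat as ℕ using (ℕ; zero; suc; _≤_; s≤s)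
  import Data.Nat.Properties as ℕ
  open import Data.List using ([]; _∷_; length)
  open import Data.Product using (_×_; _,_; proj₁; proj₂)
  open import Data.Unit.Polymorphic using (⊤)
  import Relation.Binary.PropositionalEquality as ≡
  open import Relation.Nullary using (¬_)
  open Field K
  open import Relation.Binary.Reasoning.Setoid setoid
  open CommutativeRingSolver commutativeRing
  open PolynomialEvaluation K
  open import Algebra.Properties.Ring ring using (-‿involutive; -0#≈0#)

  IsZeroP : Poly K → Set ℓ
  IsZeroP []      = ⊤
  IsZeroP (a ∷ p) = (a ≈ 0#) × IsZeroP p

  private
    nonzero-cancel : ∀ {x y} → ¬ (x ≈ 0#) → x * y ≈ 0# → y ≈ 0#
    nonzero-cancel {x} {y} x≉0 xy≈0 = let z , xz≈1 = inverse x x≉0 in begin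
      y             ≈⟨ sym (*-identityˡ y) ⟩
      1# * y        ≈⟨ *-congʳ (sym xz≈1) ⟩
      (x * z) * y   ≈⟨ solve 3 (λ x z y → (x :* z) :* y := z :* (x :* y)) refl x z y ⟩
      z * (x * y)   ≈⟨ *-congˡ xy≈0 ⟩
      z * 0#        ≈⟨ zeroʳ z ⟩
      0#            ∎

  divide : Carrier → Poly K → Poly K × Carrier
  divide c₀ []          = [] , 0#
  divide c₀ (a ∷ [])    = [] , a
  divide c₀ (a ∷ b ∷ p) = let q , r = divide c₀ (b ∷ p) in r ∷ q , a + c₀ * r

  divide-length : ∀ c₀ a p → length (proj₁ (divide c₀ (a ∷ p))) ≡.≡ length p
  divide-length c₀ a []      = ≡.refl
  divide-length c₀ a (b ∷ p) = ≡.cong suc (divide-length c₀ b p)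

  eval-divide : ∀ c₀ p x → eval K p x ≈ (x + - c₀) * eval K (proj₁ (divide c₀ p)) x + proj₂ (divide c₀ p)
  eval-divide c₀ []          x = sym (trans (+-identityʳ _) (zeroʳ _))
  eval-divide c₀ (a ∷ [])    x =
    trans (+-congˡ (zeroʳ x)) (trans (+-identityʳ a) (sym (trans (+-congʳ (zeroʳ _)) (+-identityˡ a))))
  eval-divide c₀ (a ∷ b ∷ p) x = begin
    a + x * eval K (b ∷ p) x                ≈⟨ +-congˡ (*-congˡ (eval-divide c₀ (b ∷ p) x)) ⟩
    a + x * ((x + - c₀) * Q + r)
      ≈⟨ solve 5 (λ a x c Q r → a :+ x :* ((x :+ :- c) :* Q :+ r) := (x :+ :- c) :* (r :+ x :* Q) :+ (a :+ c :* r))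
           refl a x c₀ Q r ⟩
    (x + - c₀) * (r + x * Q) + (a + c₀ * r) ∎
    where
    Q = eval K (proj₁ (divide c₀ (b ∷ p))) x
    r = proj₂ (divide c₀ (b ∷ p))

  isZeroP-divide : ∀ c₀ p → IsZeroP (proj₁ (divide c₀ p)) → proj₂ (divide c₀ p) ≈ 0# → IsZeroP p
  isZeroP-divide c₀ []          _          _    = _
  isZeroP-divide c₀ (a ∷ [])    _          r≈0  = r≈0 , _
  isZeroP-divide c₀ (a ∷ b ∷ p) (r≈0 , q≈0) a+c₀r≈0 = a≈0 , isZeroP-divide c₀ (b ∷ p) q≈0 r≈0
    where
    r = proj₂ (divide c₀ (b ∷ p))
    a≈0 : a ≈ 0#
    a≈0 = begin
      a                        ≈⟨ solve 3 (λ a c r → a := (a :+ c :* r) :+ :- (c :* r)) refl a c₀ r ⟩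
      (a + c₀ * r) + - (c₀ * r) ≈⟨ +-cong a+c₀r≈0 (-‿cong (trans (*-congˡ r≈0) (zeroʳ c₀))) ⟩
      0# + - 0#                 ≈⟨ -‿inverseʳ 0# ⟩
      0#                        ∎

  -- Dividing by X − ι k, the quotient vanishes at ι (k + 1), ι (k + 2), … because
  -- ι (suc N) is invertible in characteristic zero.
  isZeroP-vanishing : ∀ m p → length p ≤ m → ∀ k → (∀ N → eval K p (ι K (k ℕ.+ N)) ≈ 0#) → IsZeroP p
  isZeroP-vanishing m       []      _         k vanish = _
  isZeroP-vanishing (suc m) (a ∷ p) (s≤s len) k vanish = isZeroP-divide (ι K k) (a ∷ p) q≈0 r≈0
    where
    q = proj₁ (divide (ι K k) (a ∷ p))
    r = proj₂ (divide (ι K k) (a ∷ p))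
    r≈0 : r ≈ 0#
    r≈0 = begin
      r                                                   ≈⟨ solve 3 (λ r c Q → r := (c :+ :- c) :* Q :+ r) refl r (ι K k) _ ⟩
      (ι K k + - ι K k) * eval K q (ι K k) + r            ≈⟨ sym (eval-divide (ι K k) (a ∷ p) (ι K k)) ⟩
      eval K (a ∷ p) (ι K k)
        ≈⟨ ≡.subst (λ z → eval K (a ∷ p) (ι K z) ≈ 0#) (ℕ.+-identityʳ k) (vanish 0) ⟩
      0#                                                  ∎
    q-vanish : ∀ N → eval K q (ι K (suc k ℕ.+ N)) ≈ 0#
    q-vanish N = nonzero-cancel (charZero N) (begin
      ι K (suc N) * eval K q x                 ≈⟨ *-congʳ ι-difference ⟩
      (x + - ι K k) * eval K q x               ≈⟨ sym (trans (+-congˡ r≈0) (+-identityʳ _)) ⟩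
      (x + - ι K k) * eval K q x + r           ≈⟨ sym (eval-divide (ι K k) (a ∷ p) x) ⟩
      eval K (a ∷ p) x
        ≈⟨ ≡.subst (λ z → eval K (a ∷ p) (ι K z) ≈ 0#) (ℕ.+-suc k N) (vanish (suc N)) ⟩
      0#                                       ∎)
      where
      x = ι K (suc k ℕ.+ N)
      ι-difference : ι K (suc N) ≈ x + - ι K k
      ι-difference = begin
        ι K (suc N)                        ≈⟨ solve 2 (λ a b → b := (a :+ b) :+ :- a) refl (ι K k) _ ⟩
        (ι K k + ι K (suc N)) + - ι K k    ≈⟨ +-congʳ (sym (ι-+ k (suc N))) ⟩
        ι K (k ℕ.+ suc N) + - ι K k        ≈⟨ reflexive (≡.cong (λ z → ι K z + - ι K k) (ℕ.+-suc k N)) ⟩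
        x + - ι K k                        ∎
    q≈0 : IsZeroP q
    q≈0 = isZeroP-vanishing m q (≡.subst (ℕ._≤ m) (≡.sym (divide-length (ι K k) a p)) len) (suc k) q-vanish

  private
    isZeroP-≈P : ∀ p q → IsZeroP (_+P_ K p (-P q)) → _≈P_ K p q
    isZeroP-≈P []      []      _           = _
    isZeroP-≈P []      (b ∷ q) (-b≈0 , z)  = trans (sym (-‿involutive b)) (trans (-‿cong -b≈0) -0#≈0#) , isZeroP-≈P [] q z
    isZeroP-≈P (a ∷ p) []      (a≈0 , z)   = a≈0 , isZeroP⇒≈P[] p z
      where
      isZeroP⇒≈P[] : ∀ p → IsZeroP p → _≈P_ K p []
      isZeroP⇒≈P[] []      _         = _
      isZeroP⇒≈P[] (a ∷ p) (a≈0 , z) = a≈0 , isZeroP⇒≈P[] p z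
    isZeroP-≈P (a ∷ p) (b ∷ q) (a-b≈0 , z) = a≈b , isZeroP-≈P p q z
      where
      a≈b : a ≈ b
      a≈b = begin
        a                ≈⟨ solve 2 (λ a b → a := (a :+ :- b) :+ b) refl a b ⟩
        (a + - b) + b    ≈⟨ +-congʳ a-b≈0 ⟩
        0# + b           ≈⟨ +-identityˡ b ⟩
        b                ∎

  ≈P-byEvaluation : ∀ p q → (∀ N → eval K p (ι K N) ≈ eval K q (ι K N)) → _≈P_ K p q
  ≈P-byEvaluation p q agree = isZeroP-≈P p q
    (isZeroP-vanishing _ (_+P_ K p (-P q)) ℕ.≤-refl 0 λ N → begin
      eval K (_+P_ K p (-P q)) (ι K N)          ≈⟨ eval-+P p (-P q) _ ⟩
      eval K p (ι K N) + eval K (-P q) (ι K N)  ≈⟨ +-cong (agree N) (eval--P q _) ⟩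
      eval K q (ι K N) + - eval K q (ι K N)     ≈⟨ -‿inverseʳ _ ⟩
      0#                                        ∎)

module TensorEvaluation {c ℓ} (K : Field c ℓ) where
  open import Data.Nat as ℕ using (ℕ)
  open import Data.List using (List; []; _∷_; map; [_])
  open Field K
  open import Relation.Binary.Reasoning.Setoid setoid
  open CommutativeRingSolver commutativeRing
  open PolynomialEvaluation K
  open Sums using (sumOver)

  evalT : Tensor K → Carrier → Carrier → Carrier
  evalT []      x y = 0#
  evalT (q ∷ t) x y = eval K q y + x * evalT t x y

  sumOverK : ∀ {A : Set} → (A → Carrier) → List A → Carrier
  sumOverK f []       = 0#
  sumOverK f (a ∷ as) = f a + sumOverK f as

  sumOverK-cong : ∀ {A : Set} {f g : A → Carrier} → (∀ a → f a ≈ g a) → ∀ as → sumOverK f as ≈ sumOverK g as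
  sumOverK-cong f≈g []       = refl
  sumOverK-cong f≈g (a ∷ as) = +-cong (f≈g a) (sumOverK-cong f≈g as)

  ι-sumOver : ∀ {A : Set} (f : A → ℕ) as → ι K (sumOver f as) ≈ sumOverK (λ a → ι K (f a)) as
  ι-sumOver f []       = refl
  ι-sumOver f (a ∷ as) = trans (ι-+ (f a) _) (+-congˡ (ι-sumOver f as))

  evalT-+T : ∀ s t x y → evalT (_+T_ K s t) x y ≈ evalT s x y + evalT t x y
  evalT-+T []      t       x y = sym (+-identityˡ _)
  evalT-+T (p ∷ s) []      x y = sym (+-identityʳ _)
  evalT-+T (p ∷ s) (q ∷ t) x y = begin
    eval K (_+P_ K p q) y + x * evalT (_+T_ K s t) x y     ≈⟨ +-cong (eval-+P p q y) (*-congˡ (evalT-+T s t x y)) ⟩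
    (eval K p y + eval K q y) + x * (evalT s x y + evalT t x y)
      ≈⟨ solve 5 (λ a b x u v → (a :+ b) :+ x :* (u :+ v) := (a :+ x :* u) :+ (b :+ x :* v)) refl _ _ x _ _ ⟩
    (eval K p y + x * evalT s x y) + (eval K q y + x * evalT t x y) ∎

  evalT-sumT : ∀ {A : Set} (g : A → Tensor K) as x y →
    evalT (sumT K (map g as)) x y ≈ sumOverK (λ a → evalT (g a) x y) as
  evalT-sumT g []       x y = refl
  evalT-sumT g (a ∷ as) x y = trans (evalT-+T (g a) _ x y) (+-congˡ (evalT-sumT g as x y))

  evalT-⊗ : ∀ p q x y → evalT (_⊗_ K p q) x y ≈ eval K p x * eval K q y
  evalT-⊗ []      q x y = sym (zeroˡ _)
  evalT-⊗ (a ∷ p) q x y = begin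
    eval K (_·P_ K a q) y + x * evalT (_⊗_ K p q) x y  ≈⟨ +-cong (eval-·P a q y) (*-congˡ (evalT-⊗ p q x y)) ⟩
    a * eval K q y + x * (eval K p x * eval K q y)
      ≈⟨ solve 4 (λ a x u v → a :* v :+ x :* (u :* v) := (a :+ x :* u) :* v) refl a x _ _ ⟩
    (a + x * eval K p x) * eval K q y                 ∎

  private
    evalT-timesY : ∀ t x y → evalT (map (0# ∷_) t) x y ≈ y * evalT t x y
    evalT-timesY []      x y = sym (zeroʳ y)
    evalT-timesY (q ∷ t) x y = begin
      (0# + y * eval K q y) + x * evalT (map (0# ∷_) t) x y ≈⟨ +-cong (+-identityˡ _) (*-congˡ (evalT-timesY t x y)) ⟩
      y * eval K q y + x * (y * evalT t x y)
        ≈⟨ solve 4 (λ x y u v → y :* u :+ x :* (y :* v) := y :* (u :+ x :* v)) refl x y _ _ ⟩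
      y * (eval K q y + x * evalT t x y) ∎

  evalT-ΔP : ∀ p x y → evalT (ΔP K p) x y ≈ eval K p (x + y)
  evalT-ΔP []      x y = refl
  evalT-ΔP (a ∷ p) x y = begin
    evalT (_+T_ K (_+T_ K [ [ a ] ] ([] ∷ D)) (map (0# ∷_) D)) x y
      ≈⟨ evalT-+T (_+T_ K [ [ a ] ] ([] ∷ D)) (map (0# ∷_) D) x y ⟩
    evalT (_+T_ K [ [ a ] ] ([] ∷ D)) x y + evalT (map (0# ∷_) D) x y
      ≈⟨ +-cong (evalT-+T [ [ a ] ] ([] ∷ D) x y) (evalT-timesY D x y) ⟩
    ((a + y * 0#) + x * 0#) + (0# + x * evalT D x y) + y * evalT D x y
      ≈⟨ +-congʳ (+-cong (trans (+-cong (trans (+-congˡ (zeroʳ y)) (+-identityʳ a)) (zeroʳ x)) (+-identityʳ a))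
                         (+-identityˡ _)) ⟩
    a + x * evalT D x y + y * evalT D x y
      ≈⟨ solve 4 (λ a x y u → a :+ x :* u :+ y :* u := a :+ (x :+ y) :* u) refl a x y _ ⟩
    a + (x + y) * evalT D x y                 ≈⟨ +-congˡ (*-congˡ (evalT-ΔP p x y)) ⟩
    a + (x + y) * eval K p (x + y)            ∎
    where D = ΔP K p

module TensorIdentity {c ℓ} (K : Field c ℓ) (charZero : CharZero K) where
  open import Data.List using ([]; _∷_; map)
  open import Data.Product using (_,_; proj₁; proj₂)
  open Field K
  open import Relation.Binary.Reasoning.Setoid setoid
  open PolynomialIdentity K charZero using (≈P-byEvaluation)
  open TensorEvaluation K

  private
    atY : Tensor K → Carrier → Poly K
    atY t y = map (λ q → eval K q y) t

    eval-atY : ∀ t x y → eval K (atY t y) x ≈ evalT t x y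
    eval-atY []      x y = refl
    eval-atY (q ∷ t) x y = +-congˡ (*-congˡ (eval-atY t x y))

    ≈T-atY : ∀ s t → (∀ M → _≈P_ K (atY s (ι K M)) (atY t (ι K M))) → _≈T_ K s t
    ≈T-atY []      []      agree = _
    ≈T-atY []      (q ∷ t) agree = ≈P-byEvaluation q [] (λ M → proj₁ (agree M)) , ≈T-atY [] t (λ M → proj₂ (agree M))
    ≈T-atY (p ∷ s) []      agree = ≈P-byEvaluation p [] (λ M → proj₁ (agree M)) , ≈T-atY s [] (λ M → proj₂ (agree M))
    ≈T-atY (p ∷ s) (q ∷ t) agree = ≈P-byEvaluation p q (λ M → proj₁ (agree M)) , ≈T-atY s t (λ M → proj₂ (agree M))

  ≈T-byEvaluation : ∀ s t → (∀ N M → evalT s (ι K N) (ι K M) ≈ evalT t (ι K N) (ι K M)) → _≈T_ K s t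
  ≈T-byEvaluation s t agree = ≈T-atY s t λ M → ≈P-byEvaluation (atY s (ι K M)) (atY t (ι K M)) λ N →
    trans (eval-atY s _ _) (trans (agree N M) (sym (eval-atY t _ _)))

module BinomialPolynomials {c ℓ} (K : Field c ℓ) (charZero : CharZero K) where
  open import Data.Nat as ℕ using (ℕ; zero; suc)
  open import Data.Nat.Combinatorics using (_C_)
  open import Data.List using (List; []; _∷_)
  open import Data.Product using (_×_; _,_; proj₁; proj₂)
  import Relation.Binary.PropositionalEquality as ≡
  open Field K
  open import Relation.Binary.Reasoning.Setoid setoid
  open CommutativeRingSolver commutativeRing
  open PolynomialEvaluation K
  open BinomialCombinations using (evalTerms; binomial-absorption)

  private
    1/[1+_] : ℕ → Carrier
    1/[1+ k ] = proj₁ (inverse (ι K (suc k)) (charZero k))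

    X-_ : ℕ → Poly K
    X- k = - ι K k ∷ 1# ∷ []

    eval-X- : ∀ k x → eval K (X- k) x ≈ x + - ι K k
    eval-X- k x = begin
      - ι K k + x * (1# + x * 0#) ≈⟨ +-congˡ (*-congˡ (trans (+-congˡ (zeroʳ x)) (+-identityʳ 1#))) ⟩
      - ι K k + x * 1#            ≈⟨ trans (+-congˡ (*-identityʳ x)) (+-comm _ x) ⟩
      x + - ι K k                 ∎

  binomialP : ℕ → Poly K
  binomialP zero    = 1P K
  binomialP (suc k) = _·P_ K 1/[1+ k ] (_*P_ K (X- k) (binomialP k))

  eval-binomialP : ∀ k N → eval K (binomialP k) (ι K N) ≈ ι K (N C k)
  eval-binomialP zero    N = trans (eval-1P _) (sym (+-identityʳ 1#))
  eval-binomialP (suc k) N = begin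
    eval K (binomialP (suc k)) x              ≈⟨ eval-·P 1/[1+ k ] (_*P_ K (X- k) (binomialP k)) x ⟩
    1/[1+ k ] * eval K (_*P_ K (X- k) (binomialP k)) x
      ≈⟨ *-congˡ (trans (eval-*P (X- k) (binomialP k) x) (*-cong (eval-X- k x) (eval-binomialP k N))) ⟩
    1/[1+ k ] * ((x + - ι K k) * Bₖ)          ≈⟨ *-congˡ difference ⟩
    1/[1+ k ] * (ι K (suc k) * Bₖ₊₁)          ≈⟨ solve 3 (λ i s b → i :* (s :* b) := (s :* i) :* b) refl _ _ _ ⟩
    (ι K (suc k) * 1/[1+ k ]) * Bₖ₊₁          ≈⟨ *-congʳ (proj₂ (inverse (ι K (suc k)) (charZero k))) ⟩
    1# * Bₖ₊₁                                 ≈⟨ *-identityˡ Bₖ₊₁ ⟩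
    Bₖ₊₁                                      ∎
    where
    x = ι K N
    Bₖ = ι K (N C k)
    Bₖ₊₁ = ι K (N C suc k)
    absorption : ι K (suc k) * Bₖ₊₁ + ι K k * Bₖ ≈ x * Bₖ
    absorption = begin
      ι K (suc k) * Bₖ₊₁ + ι K k * Bₖ          ≈⟨ sym (+-cong (ι-* (suc k) (N C suc k)) (ι-* k (N C k))) ⟩
      ι K (suc k ℕ.* (N C suc k)) + ι K (k ℕ.* (N C k)) ≈⟨ sym (ι-+ (suc k ℕ.* (N C suc k)) (k ℕ.* (N C k))) ⟩
      ι K (suc k ℕ.* (N C suc k) ℕ.+ k ℕ.* (N C k))     ≈⟨ reflexive (≡.cong (ι K) (binomial-absorption N k)) ⟩
      ι K (N ℕ.* (N C k))                      ≈⟨ ι-* N (N C k) ⟩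
      x * Bₖ                                   ∎
    difference : (x + - ι K k) * Bₖ ≈ ι K (suc k) * Bₖ₊₁
    difference = begin
      (x + - ι K k) * Bₖ                       ≈⟨ solve 3 (λ x k b → (x :+ :- k) :* b := x :* b :+ :- (k :* b)) refl x _ Bₖ ⟩
      x * Bₖ + - (ι K k * Bₖ)                  ≈⟨ +-congʳ (sym absorption) ⟩
      (ι K (suc k) * Bₖ₊₁ + ι K k * Bₖ) + - (ι K k * Bₖ) ≈⟨ solve 2 (λ a b → (a :+ b) :+ :- b := a) refl _ _ ⟩
      ι K (suc k) * Bₖ₊₁                       ∎

  fromTerms : List (ℕ × ℕ) → Poly K
  fromTerms []             = []
  fromTerms ((c , k) ∷ ts) = _+P_ K (_·P_ K (ι K c) (binomialP k)) (fromTerms ts)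

  eval-fromTerms : ∀ ts N → eval K (fromTerms ts) (ι K N) ≈ ι K (evalTerms ts N)
  eval-fromTerms []             N = refl
  eval-fromTerms ((c , k) ∷ ts) N = begin
    eval K (fromTerms ((c , k) ∷ ts)) (ι K N)
      ≈⟨ eval-+P (_·P_ K (ι K c) (binomialP k)) (fromTerms ts) _ ⟩
    eval K (_·P_ K (ι K c) (binomialP k)) (ι K N) + eval K (fromTerms ts) (ι K N)
      ≈⟨ +-cong (trans (eval-·P (ι K c) (binomialP k) _) (*-congˡ (eval-binomialP k N))) (eval-fromTerms ts N) ⟩
    ι K c * ι K (N C k) + ι K (evalTerms ts N) ≈⟨ +-congʳ (sym (ι-* c (N C k))) ⟩
    ι K (c ℕ.* (N C k)) + ι K (evalTerms ts N) ≈⟨ sym (ι-+ (c ℕ.* (N C k)) (evalTerms ts N)) ⟩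
    ι K (evalTerms ((c , k) ∷ ts) N)          ∎

module PolynomialInvariant {c ℓ} (K : Field c ℓ) (charZero : CharZero K) where
  open import Data.Nat as ℕ using (ℕ; zero; suc; _≡ᵇ_; s≤s; z≤n)
  open import Data.List using (map)
  open import Data.Bool using (if_then_else_)
  open import Data.Fin.Subset using (Subset)
  open import Data.Product using (_,_; proj₁)
  import Relation.Binary.PropositionalEquality as ≡
  open Field K hiding (zero)
  open import Relation.Binary.Reasoning.Setoid setoid
  open Sums using (sumOver)
  open Counting
  open CountPolynomiality using (countGood-isBinomialCombination)
  open PolynomialEvaluation K
  open PolynomialIdentity K charZero
  open TensorEvaluation K
  open TensorIdentity K charZero
  open BinomialPolynomials K charZero

  P : HG → Poly K
  P G = fromTerms (proj₁ (countGood-isBinomialCombination G))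

  eval-P : ∀ G N → eval K (P G) (ι K N) ≈ ι K (countGood G N)
  eval-P G N = let ts , count≡ = countGood-isBinomialCombination G in
    trans (eval-fromTerms ts N) (reflexive (≡.cong (ι K) (≡.sym (count≡ N))))

  private
    ≈P-byCounting : ∀ p q (f : ℕ → ℕ) → (∀ N → eval K p (ι K N) ≈ ι K (f N)) →
      (∀ N → eval K q (ι K N) ≈ ι K (f N)) → _≈P_ K p q
    ≈P-byCounting p q f p≈ q≈ = ≈P-byEvaluation p q λ N → trans (p≈ N) (sym (q≈ N))

  P-Iso : ∀ G G′ → Iso G G′ → _≈P_ K (P G) (P G′)
  P-Iso G G′ iso = ≈P-byCounting (P G) (P G′) (countGood G) (eval-P G)
    (λ N → trans (eval-P G′ N) (reflexive (≡.cong (ι K) (≡.sym (countGood-Iso G G′ iso N)))))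

  P-emptyHG : _≈P_ K (P emptyHG) (1P K)
  P-emptyHG = ≈P-byCounting (P emptyHG) (1P K) (λ _ → 1)
    (λ N → trans (eval-P emptyHG N) (reflexive (≡.cong (ι K) (countGood-noVertices emptyHG ≡.refl N))))
    (λ N → trans (eval-1P _) (sym (+-identityʳ 1#)))

  P-⊎H : ∀ G G′ → _≈P_ K (P (G ⊎H G′)) (_*P_ K (P G) (P G′))
  P-⊎H G G′ = ≈P-byCounting (P (G ⊎H G′)) (_*P_ K (P G) (P G′)) (countGood (G ⊎H G′)) (eval-P (G ⊎H G′)) λ N → begin
    eval K (_*P_ K (P G) (P G′)) (ι K N)         ≈⟨ eval-*P (P G) (P G′) (ι K N) ⟩
    eval K (P G) (ι K N) * eval K (P G′) (ι K N) ≈⟨ *-cong (eval-P G N) (eval-P G′ N) ⟩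
    ι K (countGood G N) * ι K (countGood G′ N)   ≈⟨ sym (ι-* (countGood G N) (countGood G′ N)) ⟩
    ι K (countGood G N ℕ.* countGood G′ N)       ≈⟨ reflexive (≡.cong (ι K) (≡.sym (countGood-⊎H G G′ N))) ⟩
    ι K (countGood (G ⊎H G′) N)                  ∎

  P-Δ : ∀ G → _≈T_ K (ΔP K (P G))
    (sumT K (map (λ I → _⊗_ K (P (restrictSub G I)) (P (restrictCap G (complement I)))) (allSubsets (n G))))
  P-Δ G = ≈T-byEvaluation (ΔP K (P G)) (sumT K (map tensor subsets)) λ N M → begin
    evalT (ΔP K (P G)) (ι K N) (ι K M)         ≈⟨ evalT-ΔP (P G) (ι K N) (ι K M) ⟩
    eval K (P G) (ι K N + ι K M)               ≈⟨ eval-cong (P G) (sym (ι-+ N M)) ⟩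
    eval K (P G) (ι K (N ℕ.+ M))               ≈⟨ eval-P G (N ℕ.+ M) ⟩
    ι K (countGood G (N ℕ.+ M))                ≈⟨ reflexive (≡.cong (ι K) (countGood-+ G N M)) ⟩
    ι K (sumOver (λ I → low I N ℕ.* high I M) subsets)            ≈⟨ ι-sumOver (λ I → low I N ℕ.* high I M) subsets ⟩
    sumOverK (λ I → ι K (low I N ℕ.* high I M)) subsets           ≈⟨ sumOverK-cong (term N M) subsets ⟩
    sumOverK (λ I → evalT (tensor I) (ι K N) (ι K M)) subsets     ≈⟨ sym (evalT-sumT tensor subsets (ι K N) (ι K M)) ⟩
    evalT (sumT K (map tensor subsets)) (ι K N) (ι K M)           ∎
    where
    subsets = allSubsets (n G)
    low high : Subset (n G) → ℕ → ℕ
    low I = countGood (restrictSub G I)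
    high I = countGood (restrictCap G (complement I))
    tensor : Subset (n G) → Tensor K
    tensor I = _⊗_ K (P (restrictSub G I)) (P (restrictCap G (complement I)))
    term : ∀ N M I → ι K (low I N ℕ.* high I M) ≈ evalT (tensor I) (ι K N) (ι K M)
    term N M I = trans (ι-* (low I N) (high I M)) (sym (trans
      (evalT-⊗ (P (restrictSub G I)) (P (restrictCap G (complement I))) (ι K N) (ι K M))
      (*-cong (eval-P (restrictSub G I) N) (eval-P (restrictCap G (complement I)) M))))

  P-ε : ∀ G → εP K (P G) ≈ (if (n G ≡ᵇ 0) then 1# else 0#)
  P-ε G = trans (eval-P G 0) (counit G)
    where
    counit : ∀ G → ι K (countGood G 0) ≈ (if (n G ≡ᵇ 0) then 1# else 0#)
    counit (hg zero E)    = trans (reflexive (≡.cong (ι K) (countGood-noVertices (hg zero E) ≡.refl 0))) (+-identityʳ 1#)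
    counit (hg (suc k) E) = reflexive (≡.cong (ι K) (countGood-noColours (hg (suc k) E) (s≤s z≤n)))


mainTheorem6 : {c ℓ : Level} (K : Field c ℓ) → CharZero K →
  Σ (HG → Poly K) λ P →
    -- P(G)(N) counts the maps V(G) → {1..N} with unique maxima on edges of size ≥ 2
    ((G : HG) → IsHypergraph G → (N : ℕ) → 1 ≤ N →
       Field._≈_ K (eval K (P G) (ι K N)) (ι K (countGood G N)))
    -- P is well defined on isomorphism classes
    × ((G G′ : HG) → IsHypergraph G → IsHypergraph G′ → Iso G G′ →
       _≈P_ K (P G) (P G′))
    -- unit
    × _≈P_ K (P emptyHG) (1P K)
    -- multiplicativity
    × ((G G′ : HG) → IsHypergraph G → IsHypergraph G′ →
       _≈P_ K (P (G ⊎H G′)) (_*P_ K (P G) (P G′)))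
    -- comultiplicativity: Δ(P(G)) = Σ_I P(G|⊂I) ⊗ P(G|∩ V∖I)
    × ((G : HG) → IsHypergraph G →
       _≈T_ K (ΔP K (P G))
         (sumT K (map (λ I → _⊗_ K (P (restrictSub G I)) (P (restrictCap G (complement I))))
                      (allSubsets (n G)))))
    -- counit: ε(P(G)) = ε(G), which is 1 if V(G) = ∅ and 0 otherwise
    × ((G : HG) → IsHypergraph G →
       Field._≈_ K (εP K (P G)) (if (n G ≡ᵇ 0) then Field.1# K else Field.0# K))
mainTheorem6 K charZero =
  P , (λ G _ N _ → eval-P G N) , (λ G G′ _ _ → P-Iso G G′) , P-emptyHG ,
  (λ G G′ _ _ → P-⊎H G G′) , (λ G _ → P-Δ G) , (λ G _ → P-ε G)
  where open PolynomialInvariant K charZero
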